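{- For all $n\ge1$, \[a_{\{0101,0102,0112\}}(n)=a_{\{0101,0102,0120\}}(n)=a_{\{0101,0102,0121\}}(n)=a_{\{0101,0112,0121\}}(n)=a_{\{0101,0120,0121\}}(n)=a_{\{0102,0120,0121\}}(n)=2^n-n.\]
   Context: An ascent in an integer sequence $s_1\cdots s_m$ is an index $j$ with $s_j<s_{j+1}$; $\mathrm{asc}(s)$ is the number of ascents. An ascent sequence is a sequence $x_1\cdots x_n$ of nonnegative integers with $x_1=0$ and $x_i\le 1+\mathrm{asc}(x_1\cdots x_{i-1})$ for $i\ge2$. For a sequence $w$, $\mathrm{red}(w)$ replaces the $i$-th smallest distinct letter of $w$ by $i-1$. A pattern (e.g. $0101$, meaning the sequence $(0,1,0,1)$) is a sequence equal to its reduction. A sequence $x$ contains pattern $p=p_1\cdots p_k$ if there are indices $i_1<\cdots<i_k$ with $\mathrm{red}(x_{i_1}\cdots x_{i_k})=p$; otherwise it avoids $p$. For a set of patterns $P$, $\mathcal A_n(P)$ is the set of ascent sequences of length $n$ avoiding every pattern in $P$, and $a_P(n)=|\mathcal A_n(P)|$. -}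

module Defs where

open import Data.Bool using (if_then_else_)
open import Data.Nat using (_<ᵇ_; ℕ; zero; suc; _+_; _≤_; _<_; _<?_; _≟_)
open import Data.List using (List; []; _∷_; length; map; filter; deduplicate; take; lookup; _++_)
open import Data.List.Membership.Propositional using (_∈_)
open import Data.List.Relation.Unary.Unique.Propositional using (Unique)
open import Data.Fin using (Fin; toℕ)
open import Data.Product using (Σ; _×_; ∃)
open import Relation.Nullary using (¬_)
open import Relation.Binary.PropositionalEquality using (_≡_)
open import Function.Bundles using (_⇔_)

ascFrom : ℕ → List ℕ → ℕ
ascFrom x [] = 0
ascFrom x (y ∷ s) = (if x <ᵇ y then 1 else 0) + ascFrom y s

asc : List ℕ → ℕ
asc [] = 0
asc (x ∷ s) = ascFrom x s

-- ascent sequence: x_1 = 0 and x_i ≤ 1 + asc(x_1 ⋯ x_{i-1}) for i ≥ 2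
-- (index i here is 0-based; for i = 0 the prefix is empty, asc [] = 0,
--  and the condition x_1 = 0 is imposed separately)
IsAscentSeq : List ℕ → Set
IsAscentSeq [] = Data.Unit.⊤ where import Data.Unit
IsAscentSeq (x ∷ xs) =
  (x ≡ 0) ×
  ((i : Fin (length (x ∷ xs))) → lookup (x ∷ xs) i ≤ suc (asc (take (toℕ i) (x ∷ xs))))

red : List ℕ → List ℕ
red w = map (λ x → length (filter (_<? x) (deduplicate _≟_ w))) w

data Subseq : List ℕ → List ℕ → Set where
  done : Subseq [] []
  skip : ∀ {s x} a → Subseq s x → Subseq s (a ∷ x)
  keep : ∀ {s x} a → Subseq s x → Subseq (a ∷ s) (a ∷ x)

Contains : List ℕ → List ℕ → Set
Contains x p = ∃ λ s → Subseq s x × (red s ≡ p)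

Avoids : List ℕ → List ℕ → Set
Avoids x p = ¬ Contains x p

InA : ℕ → List (List ℕ) → List ℕ → Set
InA n P x = IsAscentSeq x × (length x ≡ n) × (∀ {p} → p ∈ P → Avoids x p)

-- a_P(n) = k : there is a duplicate-free list enumerating exactly 𝒜_n(P), of length k
HasCount : ℕ → List (List ℕ) → ℕ → Set
HasCount n P k = Σ (List (List ℕ)) λ L →
  Unique L × (∀ x → (x ∈ L) ⇔ InA n P x) × (length L ≡ k)

{-# OPTIONS --safe #-}

-- Each class is enumerated by a generating tree.  An ascent sequence 0 ∷ t avoiding the three
-- patterns is grown one letter at a time, and a small state (essentially the current maximum, the
-- last letter and whether the sequence has already turned down) determines exactly which letters
-- may be appended.  Appending d can only create an occurrence that ends in d and whose first three
-- letters form a subsequence of 0 ∷ t; each state carries invariants (order constraints and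
-- witnessed subsequences such as 0 d 0 or 0 w w) which exclude every such occurrence for the
-- allowed letters and exhibit one for every other letter within the ascent bound.  Counting nodes
-- by depth, the subtree entered at the first nonzero letter has 2^(L+1) − 1 nodes of depth L
-- (through binomial row sums for {0101, 0102, 0112}), and the initial run of zeros contributes one
-- such subtree for every length, which gives 2^n − n.
module Submission where

open import Defs
open import Data.Bool using (true; false; if_then_else_)
open import Data.Empty using (⊥; ⊥-elim)
open import Data.Fin using (Fin; toℕ) renaming (zero to fzero; suc to fsuc)
open import Data.List using (List; []; _∷_; _++_; _∷ʳ_; length; lookup; take; map; filter; deduplicate; downFrom)
open import Data.List.Properties using (∷-injective; ∷-injectiveˡ; ∷-injectiveʳ; ++-assoc; ++-identityʳ; length-++; length-map; map-∘; map-cong; map-cong-local; filter-accept; filter-reject)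
open import Data.List.Membership.Propositional using (_∈_)
open import Data.List.Membership.Propositional.Properties using (∈-deduplicate⁺; ∈-map⁺; ∈-map⁻; ∈-++⁺ˡ; ∈-++⁺ʳ; ∈-++⁻; ∈-downFrom⁺; ∈-downFrom⁻)
import Data.List.Relation.Binary.Sublist.Propositional as Sublist
import Data.List.Relation.Binary.Sublist.Propositional.Properties as Sublistₚ
open import Data.List.Relation.Unary.All as All using (All; []; _∷_)
open import Data.List.Relation.Unary.AllPairs using ([]; _∷_)
open import Data.List.Relation.Unary.Any using (here; there)
open import Data.List.Relation.Unary.Unique.Propositional using (Unique)
import Data.List.Relation.Unary.Unique.Propositional.Properties as Unique
open import Data.Nat
open import Data.Nat.Combinatorics using (_C_; nCk+nC[k+1]≡[n+1]C[k+1]; k>n⇒nCk≡0; nCn≡1)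
open import Data.Nat.ListAction using (sum)
open import Data.Nat.Properties
open import Data.Nat.Tactic.RingSolver using (solve-∀)
open import Data.Product using (∃; _×_; _,_; proj₁; proj₂)
open import Data.Sum using (_⊎_; inj₁; inj₂)
open import Data.Unit using (⊤; tt)
open import Function using (_∘_; case_of_; _⇔_; mk⇔; Equivalence)
open import Relation.Binary.Definitions using (tri<; tri≈; tri>)
open import Relation.Binary.PropositionalEquality
open import Relation.Nullary using (¬_; yes; no; contradiction)
open import Relation.Nullary.Decidable using (¬?)
import Relation.Unary as U

-- Ascent sequences read left to right

ascentStep : ℕ → ℕ → ℕ
ascentStep x y = if x <ᵇ y then 1 else 0

<ᵇ-true : ∀ {x y} → x < y → (x <ᵇ y) ≡ true
<ᵇ-true {zero} {suc y} _ = refl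
<ᵇ-true {suc x} {suc y} (s≤s x<y) = <ᵇ-true x<y

<ᵇ-false : ∀ {x y} → y ≤ x → (x <ᵇ y) ≡ false
<ᵇ-false {x} {zero} _ = refl
<ᵇ-false {suc x} {suc y} (s≤s y≤x) = <ᵇ-false y≤x

ascentStep-< : ∀ {x y} → x < y → ascentStep x y ≡ 1
ascentStep-< x<y rewrite <ᵇ-true x<y = refl

ascentStep-≥ : ∀ {x y} → y ≤ x → ascentStep x y ≡ 0
ascentStep-≥ y≤x rewrite <ᵇ-false y≤x = refl

lastOr : ℕ → List ℕ → ℕ
lastOr x [] = x
lastOr x (y ∷ ys) = lastOr y ys

lastOr-∷ʳ : ∀ x xs d → lastOr x (xs ∷ʳ d) ≡ d
lastOr-∷ʳ x [] d = refl
lastOr-∷ʳ x (y ∷ ys) d = lastOr-∷ʳ y ys d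

ascFrom-∷ʳ : ∀ x xs d → ascFrom x (xs ∷ʳ d) ≡ ascFrom x xs + ascentStep (lastOr x xs) d
ascFrom-∷ʳ x [] d = +-identityʳ _
ascFrom-∷ʳ x (y ∷ ys) d = begin
  ascentStep x y + ascFrom y (ys ∷ʳ d)                          ≡⟨ cong (ascentStep x y +_) (ascFrom-∷ʳ y ys d) ⟩
  ascentStep x y + (ascFrom y ys + ascentStep (lastOr y ys) d)  ≡⟨ +-assoc (ascentStep x y) _ _ ⟨
  ascentStep x y + ascFrom y ys + ascentStep (lastOr y ys) d    ∎
  where open ≡-Reasoning

≤suc-≡ : ∀ {d m n} → m ≡ n → d ≤ suc m → d ≤ suc n
≤suc-≡ refl d≤ = d≤

-- Admissible l a xs: xs may follow a prefix ending in l with a ascents.  PrefixBounded is the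
-- same condition in the index-wise form used by IsAscentSeq.
Admissible : ℕ → ℕ → List ℕ → Set
Admissible l a [] = ⊤
Admissible l a (y ∷ ys) = y ≤ suc a × Admissible y (a + ascentStep l y) ys

AscentTail : List ℕ → Set
AscentTail = Admissible 0 0

PrefixBounded : ℕ → ℕ → List ℕ → Set
PrefixBounded l a xs = (j : Fin (length xs)) → lookup xs j ≤ suc (a + ascFrom l (take (toℕ j) xs))

prefixBounded⇒admissible : ∀ l a xs → PrefixBounded l a xs → Admissible l a xs
prefixBounded⇒admissible l a [] bounded = tt
prefixBounded⇒admissible l a (y ∷ ys) bounded =
  ≤suc-≡ (+-identityʳ a) (bounded fzero) ,
  prefixBounded⇒admissible y (a + ascentStep l y) ys
    (λ j → ≤suc-≡ (sym (+-assoc a (ascentStep l y) _)) (bounded (fsuc j)))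

admissible⇒prefixBounded : ∀ l a xs → Admissible l a xs → PrefixBounded l a xs
admissible⇒prefixBounded l a (y ∷ ys) (y≤ , _) fzero = ≤suc-≡ (sym (+-identityʳ a)) y≤
admissible⇒prefixBounded l a (y ∷ ys) (_ , adm) (fsuc j) =
  ≤suc-≡ (+-assoc a (ascentStep l y) _) (admissible⇒prefixBounded y _ ys adm j)

ascentTail⇒IsAscentSeq : ∀ t → AscentTail t → IsAscentSeq (0 ∷ t)
ascentTail⇒IsAscentSeq t adm = refl , λ { fzero → z≤n ; (fsuc j) → admissible⇒prefixBounded 0 0 t adm j }

IsAscentSeq⇒ascentTail : ∀ x t → IsAscentSeq (x ∷ t) → x ≡ 0 × AscentTail t
IsAscentSeq⇒ascentTail .0 t (refl , bounded) = refl , prefixBounded⇒admissible 0 0 t (bounded ∘ fsuc)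

admissible-∷ʳ⁺ : ∀ l a xs {d} → Admissible l a xs → d ≤ suc (a + ascFrom l xs) → Admissible l a (xs ∷ʳ d)
admissible-∷ʳ⁺ l a [] _ d≤ = ≤suc-≡ (+-identityʳ a) d≤ , tt
admissible-∷ʳ⁺ l a (y ∷ ys) (y≤ , adm) d≤ =
  y≤ , admissible-∷ʳ⁺ y _ ys adm (≤suc-≡ (sym (+-assoc a (ascentStep l y) _)) d≤)

admissible-∷ʳ⁻ : ∀ l a xs {d} → Admissible l a (xs ∷ʳ d) → d ≤ suc (a + ascFrom l xs)
admissible-∷ʳ⁻ l a [] (d≤ , _) = ≤suc-≡ (sym (+-identityʳ a)) d≤
admissible-∷ʳ⁻ l a (y ∷ ys) (_ , adm) =
  ≤suc-≡ (+-assoc a (ascentStep l y) _) (admissible-∷ʳ⁻ y _ ys adm)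

admissible-++⁻ : ∀ l a xs ys → Admissible l a (xs ++ ys) → Admissible l a xs
admissible-++⁻ l a [] ys _ = tt
admissible-++⁻ l a (x ∷ xs) ys (x≤ , adm) = x≤ , admissible-++⁻ x _ xs ys adm

lastOr≤suc-ascents : ∀ l a xs → l ≤ suc a → Admissible l a xs → lastOr l xs ≤ suc (a + ascFrom l xs)
lastOr≤suc-ascents l a [] l≤ _ = ≤suc-≡ (sym (+-identityʳ a)) l≤
lastOr≤suc-ascents l a (y ∷ ys) _ (y≤ , adm) =
  ≤suc-≡ (+-assoc a (ascentStep l y) _)
    (lastOr≤suc-ascents y _ ys (≤-trans y≤ (s≤s (m≤m+n a _))) adm)

asc-∷ʳ-rise : ∀ t {d} → lastOr 0 t < d → asc ((0 ∷ t) ∷ʳ d) ≡ suc (asc (0 ∷ t))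
asc-∷ʳ-rise t {d} last<d = begin
  ascFrom 0 (t ∷ʳ d)                          ≡⟨ ascFrom-∷ʳ 0 t d ⟩
  ascFrom 0 t + ascentStep (lastOr 0 t) d     ≡⟨ cong (ascFrom 0 t +_) (ascentStep-< last<d) ⟩
  ascFrom 0 t + 1                             ≡⟨ +-comm (ascFrom 0 t) 1 ⟩
  suc (ascFrom 0 t)                           ∎
  where open ≡-Reasoning

asc-∷ʳ-flat : ∀ t {d} → d ≤ lastOr 0 t → asc ((0 ∷ t) ∷ʳ d) ≡ asc (0 ∷ t)
asc-∷ʳ-flat t {d} d≤last = begin
  ascFrom 0 (t ∷ʳ d)                          ≡⟨ ascFrom-∷ʳ 0 t d ⟩
  ascFrom 0 t + ascentStep (lastOr 0 t) d     ≡⟨ cong (ascFrom 0 t +_) (ascentStep-≥ d≤last) ⟩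
  ascFrom 0 t + 0                             ≡⟨ +-identityʳ _ ⟩
  ascFrom 0 t                                 ∎
  where open ≡-Reasoning

-- Subsequences

subseq-[] : ∀ u → Subseq [] u
subseq-[] [] = done
subseq-[] (a ∷ u) = skip a (subseq-[] u)

subseq-trans : ∀ {s t u} → Subseq s t → Subseq t u → Subseq s u
subseq-trans s⊑t done = s⊑t
subseq-trans s⊑t (skip a t⊑u) = skip a (subseq-trans s⊑t t⊑u)
subseq-trans (skip _ s⊑t) (keep a t⊑u) = skip a (subseq-trans s⊑t t⊑u)
subseq-trans (keep _ s⊑t) (keep a t⊑u) = keep a (subseq-trans s⊑t t⊑u)

skipLast : ∀ {s u} d → Subseq s u → Subseq s (u ∷ʳ d)
skipLast d done = skip d done
skipLast d (skip a s⊑u) = skip a (skipLast d s⊑u)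
skipLast d (keep a s⊑u) = keep a (skipLast d s⊑u)

subseq-++ʳ : ∀ {s u} v → Subseq s u → Subseq s (u ++ v)
subseq-++ʳ v done = subseq-[] v
subseq-++ʳ v (skip a s⊑u) = skip a (subseq-++ʳ v s⊑u)
subseq-++ʳ v (keep a s⊑u) = keep a (subseq-++ʳ v s⊑u)

keepLast : ∀ {s u} d → Subseq s u → Subseq (s ∷ʳ d) (u ∷ʳ d)
keepLast d done = keep d done
keepLast d (skip a s⊑u) = skip a (keepLast d s⊑u)
keepLast d (keep a s⊑u) = keep a (keepLast d s⊑u)

subseq-∷ʳ⁻ : ∀ {s} u d → Subseq s (u ∷ʳ d) → Subseq s u ⊎ ∃ λ s′ → s ≡ s′ ∷ʳ d × Subseq s′ u
subseq-∷ʳ⁻ [] d (skip _ done) = inj₁ done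
subseq-∷ʳ⁻ [] d (keep _ done) = inj₂ ([] , refl , done)
subseq-∷ʳ⁻ (a ∷ u) d (skip _ s⊑ud) with subseq-∷ʳ⁻ u d s⊑ud
... | inj₁ s⊑u = inj₁ (skip a s⊑u)
... | inj₂ (s′ , refl , s′⊑u) = inj₂ (s′ , refl , skip a s′⊑u)
subseq-∷ʳ⁻ (a ∷ u) d (keep _ s⊑ud) with subseq-∷ʳ⁻ u d s⊑ud
... | inj₁ s⊑u = inj₁ (keep a s⊑u)
... | inj₂ (s′ , refl , s′⊑u) = inj₂ (a ∷ s′ , refl , keep a s′⊑u)

Sub₁ : ℕ → List ℕ → Set
Sub₁ a = Subseq (a ∷ [])

Sub₂ : ℕ → ℕ → List ℕ → Set
Sub₂ a b = Subseq (a ∷ b ∷ [])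

Sub₃ : ℕ → ℕ → ℕ → List ℕ → Set
Sub₃ a b c = Subseq (a ∷ b ∷ c ∷ [])

Sub₁-∷ʳ⁻ : ∀ {a} u d → Sub₁ a (u ∷ʳ d) → Sub₁ a u ⊎ a ≡ d
Sub₁-∷ʳ⁻ u d occ with subseq-∷ʳ⁻ u d occ
... | inj₁ occ′ = inj₁ occ′
... | inj₂ ([] , refl , _) = inj₂ refl
... | inj₂ (_ ∷ _ ∷ _ , () , _)
... | inj₂ (_ ∷ [] , () , _)

Sub₂-∷ʳ⁻ : ∀ {a b} u d → Sub₂ a b (u ∷ʳ d) → Sub₂ a b u ⊎ Sub₁ a u × b ≡ d
Sub₂-∷ʳ⁻ u d occ with subseq-∷ʳ⁻ u d occ
... | inj₁ occ′ = inj₁ occ′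
... | inj₂ (_ ∷ [] , refl , occ′) = inj₂ (occ′ , refl)
... | inj₂ ([] , () , _)
... | inj₂ (_ ∷ _ ∷ _ ∷ _ , () , _)
... | inj₂ (_ ∷ _ ∷ [] , () , _)

Sub₃-∷ʳ⁻ : ∀ {a b c} u d → Sub₃ a b c (u ∷ʳ d) → Sub₃ a b c u ⊎ Sub₂ a b u × c ≡ d
Sub₃-∷ʳ⁻ u d occ with subseq-∷ʳ⁻ u d occ
... | inj₁ occ′ = inj₁ occ′
... | inj₂ (_ ∷ _ ∷ [] , refl , occ′) = inj₂ (occ′ , refl)
... | inj₂ ([] , () , _)
... | inj₂ (_ ∷ [] , () , _)
... | inj₂ (_ ∷ _ ∷ _ ∷ [] , () , _)
... | inj₂ (_ ∷ _ ∷ _ ∷ _ ∷ _ , () , _)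

Sub₂⇒Sub₁ˡ : ∀ {a b u} → Sub₂ a b u → Sub₁ a u
Sub₂⇒Sub₁ˡ = subseq-trans (keep _ (skip _ done))

Sub₂⇒Sub₁ʳ : ∀ {a b u} → Sub₂ a b u → Sub₁ b u
Sub₂⇒Sub₁ʳ = subseq-trans (skip _ (keep _ done))

Sub₃⇒Sub₂ˡ : ∀ {a b c u} → Sub₃ a b c u → Sub₂ a b u
Sub₃⇒Sub₂ˡ = subseq-trans (keep _ (keep _ (skip _ done)))

Sub₃⇒Sub₂ʳ : ∀ {a b c u} → Sub₃ a b c u → Sub₂ b c u
Sub₃⇒Sub₂ʳ = subseq-trans (skip _ (keep _ (keep _ done)))

-- Reduction

rank : List ℕ → ℕ → ℕ
rank D x = length (filter (_<? x) D)

rank-mono : ∀ D {x y} → x ≤ y → rank D x ≤ rank D y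
rank-mono D {x} {y} x≤y = Sublistₚ.length-mono-≤
  (Sublistₚ.filter⁺ (_<? x) (_<? y) (λ { refl z<x → <-≤-trans z<x x≤y }) (Sublist.⊆-refl {x = D}))

rank-≤-∷ : ∀ z D x → rank D x ≤ rank (z ∷ D) x
rank-≤-∷ z D x = Sublistₚ.length-mono-≤
  (Sublistₚ.filter⁺ (_<? x) (_<? x) (λ { refl z<x → z<x }) (z Sublist.∷ʳ Sublist.⊆-refl {x = D}))

rank-accept : ∀ {z x} D → z < x → rank (z ∷ D) x ≡ suc (rank D x)
rank-accept {x = x} D z<x = cong length (filter-accept (_<? x) z<x)

rank-reject : ∀ {z x} D → ¬ z < x → rank (z ∷ D) x ≡ rank D x
rank-reject {x = x} D z≮x = cong length (filter-reject (_<? x) z≮x)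

rank-strict : ∀ D {x y} → x ∈ D → x < y → rank D x < rank D y
rank-strict (z ∷ D) {x} {y} (here refl) x<y = begin-strict
  rank (x ∷ D) x  ≡⟨ rank-reject D (<-irrefl refl) ⟩
  rank D x        ≤⟨ rank-mono D (<⇒≤ x<y) ⟩
  rank D y        <⟨ n<1+n (rank D y) ⟩
  suc (rank D y)  ≡⟨ rank-accept D x<y ⟨
  rank (x ∷ D) y  ∎
  where open ≤-Reasoning
rank-strict (z ∷ D) {x} {y} (there x∈D) x<y with z <? x
... | yes z<x = begin-strict
  rank (z ∷ D) x  ≡⟨ rank-accept D z<x ⟩
  suc (rank D x)  <⟨ s≤s (rank-strict D x∈D x<y) ⟩
  suc (rank D y)  ≡⟨ rank-accept D (<-trans z<x x<y) ⟨
  rank (z ∷ D) y  ∎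
  where open ≤-Reasoning
... | no z≮x = begin-strict
  rank (z ∷ D) x  ≡⟨ rank-reject D z≮x ⟩
  rank D x        <⟨ rank-strict D x∈D x<y ⟩
  rank D y        ≤⟨ rank-≤-∷ z D y ⟩
  rank (z ∷ D) y  ∎
  where open ≤-Reasoning

-- red s = map (letterRank s) s holds by definition.
letterRank : List ℕ → ℕ → ℕ
letterRank s = rank (deduplicate _≟_ s)

letterRank-<⁻ : ∀ s {x y} → letterRank s x < letterRank s y → x < y
letterRank-<⁻ s {x} {y} rx<ry with <-cmp x y
... | tri< x<y _ _ = x<y
... | tri≈ _ refl _ = contradiction rx<ry (<-irrefl refl)
... | tri> _ _ y<x = contradiction (rank-mono (deduplicate _≟_ s) (<⇒≤ y<x)) (<⇒≱ rx<ry)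

letterRank-injective : ∀ s {x y} → x ∈ s → y ∈ s → letterRank s x ≡ letterRank s y → x ≡ y
letterRank-injective s {x} {y} x∈s y∈s rx≡ry with <-cmp x y
... | tri< x<y _ _ = contradiction rx≡ry (<⇒≢ (rank-strict _ (∈-deduplicate⁺ _≟_ x∈s) x<y))
... | tri≈ _ x≡y _ = x≡y
... | tri> _ _ y<x = contradiction (sym rx≡ry) (<⇒≢ (rank-strict _ (∈-deduplicate⁺ _≟_ y∈s) y<x))

filter-map : ∀ {A B : Set} {P : B → Set} {Q : A → Set} (P? : U.Decidable P) (Q? : U.Decidable Q) {f : A → B} →
             (∀ x → P (f x) ⇔ Q x) → ∀ xs → filter P? (map f xs) ≡ map f (filter Q? xs)
filter-map P? Q? P⇔Q [] = refl
filter-map P? Q? {f} P⇔Q (x ∷ xs) = case Q? x of λ where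
    (yes qx) → begin
      filter P? (f x ∷ map f xs)  ≡⟨ filter-accept P? (Equivalence.from (P⇔Q x) qx) ⟩
      f x ∷ filter P? (map f xs)  ≡⟨ cong (f x ∷_) (filter-map P? Q? P⇔Q xs) ⟩
      f x ∷ map f (filter Q? xs)  ≡⟨ cong (map f) (filter-accept Q? qx) ⟨
      map f (filter Q? (x ∷ xs))  ∎
    (no ¬qx) → begin
      filter P? (f x ∷ map f xs)  ≡⟨ filter-reject P? (¬qx ∘ Equivalence.to (P⇔Q x)) ⟩
      filter P? (map f xs)        ≡⟨ filter-map P? Q? P⇔Q xs ⟩
      map f (filter Q? xs)        ≡⟨ cong (map f) (filter-reject Q? ¬qx) ⟨
      map f (filter Q? (x ∷ xs))  ∎
  where open ≡-Reasoning

module _ {f : ℕ → ℕ} (f-mono : ∀ {x y} → x < y → f x < f y) where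

  private
    f-<⇔ : ∀ {x y} → f x < f y ⇔ x < y
    f-<⇔ {x} {y} = mk⇔ reflect f-mono
      where
      reflect : f x < f y → x < y
      reflect fx<fy with <-cmp x y
      ... | tri< x<y _ _ = x<y
      ... | tri≈ _ refl _ = contradiction fx<fy (<-irrefl refl)
      ... | tri> _ _ y<x = contradiction (f-mono y<x) (<⇒≯ fx<fy)

    f-≢⇔ : ∀ {x y} → (f x ≢ f y) ⇔ (x ≢ y)
    f-≢⇔ {x} {y} = mk⇔ (λ fx≢fy x≡y → fx≢fy (cong f x≡y)) reflect
      where
      reflect : x ≢ y → f x ≢ f y
      reflect x≢y fx≡fy with <-cmp x y
      ... | tri< x<y _ _ = <⇒≢ (f-mono x<y) fx≡fy
      ... | tri≈ _ x≡y _ = x≢y x≡y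
      ... | tri> _ _ y<x = <⇒≢ (f-mono y<x) (sym fx≡fy)

  deduplicate-map : ∀ xs → deduplicate _≟_ (map f xs) ≡ map f (deduplicate _≟_ xs)
  deduplicate-map [] = refl
  deduplicate-map (x ∷ xs) = cong (f x ∷_) (begin
    filter (¬? ∘ (f x ≟_)) (deduplicate _≟_ (map f xs))
      ≡⟨ cong (filter (¬? ∘ (f x ≟_))) (deduplicate-map xs) ⟩
    filter (¬? ∘ (f x ≟_)) (map f (deduplicate _≟_ xs))
      ≡⟨ filter-map (¬? ∘ (f x ≟_)) (¬? ∘ (x ≟_)) (λ _ → f-≢⇔) (deduplicate _≟_ xs) ⟩
    map f (filter (¬? ∘ (x ≟_)) (deduplicate _≟_ xs))
      ∎)
    where open ≡-Reasoning

  red-map : ∀ s → red (map f s) ≡ red s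
  red-map s = begin
    map (letterRank (map f s)) (map f s)  ≡⟨ map-∘ s ⟨
    map (letterRank (map f s) ∘ f) s      ≡⟨ map-cong rank-f s ⟩
    map (letterRank s) s                  ∎
    where
    open ≡-Reasoning
    rank-f : ∀ x → letterRank (map f s) (f x) ≡ letterRank s x
    rank-f x = begin
      length (filter (_<? f x) (deduplicate _≟_ (map f s)))
        ≡⟨ cong (length ∘ filter (_<? f x)) (deduplicate-map s) ⟩
      length (filter (_<? f x) (map f (deduplicate _≟_ s)))
        ≡⟨ cong length (filter-map (_<? f x) (_<? x) (λ _ → f-<⇔) (deduplicate _≟_ s)) ⟩
      length (map f (filter (_<? x) (deduplicate _≟_ s)))
        ≡⟨ length-map f (filter (_<? x) (deduplicate _≟_ s)) ⟩
      length (filter (_<? x) (deduplicate _≟_ s))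
        ∎

stretch : ℕ → ℕ → ℕ → ℕ → ℕ
stretch a b c 0 = a
stretch a b c 1 = b
stretch a b c 2 = c
stretch a b c (suc (suc (suc n))) = suc (c + n)

stretch-mono : ∀ {a b c} → a < b → b < c → ∀ {x y} → x < y → stretch a b c x < stretch a b c y
stretch-mono a<b b<c {0} {1} _ = a<b
stretch-mono a<b b<c {0} {2} _ = <-trans a<b b<c
stretch-mono {c = c} a<b b<c {0} {suc (suc (suc n))} _ = <-trans (<-trans a<b b<c) (s≤s (m≤m+n c n))
stretch-mono a<b b<c {1} {2} _ = b<c
stretch-mono {c = c} a<b b<c {1} {suc (suc (suc n))} _ = <-trans b<c (s≤s (m≤m+n c n))
stretch-mono {c = c} a<b b<c {2} {suc (suc (suc n))} _ = s≤s (m≤m+n c n)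
stretch-mono _ _ {1} {1} (s≤s ())
stretch-mono _ _ {2} {1} (s≤s ())
stretch-mono _ _ {2} {2} (s≤s (s≤s ()))
stretch-mono {c = c} a<b b<c {suc (suc (suc m))} {suc (suc (suc n))} (s≤s (s≤s (s≤s m<n))) = s≤s (+-monoʳ-< c m<n)

-- s is explicit, and the relabelling checked by refl, so that red is never unfolded on open terms.
red-stretch : ∀ {a b c} s p → a < b → b < c → map (stretch a b c) p ≡ s → red s ≡ red p
red-stretch s p a<b b<c refl = red-map (stretch-mono a<b b<c) p

-- Patterns of length four

p0101 p0102 p0112 p0120 p0121 : List ℕ
p0101 = 0 ∷ 1 ∷ 0 ∷ 1 ∷ []
p0102 = 0 ∷ 1 ∷ 0 ∷ 2 ∷ []
p0112 = 0 ∷ 1 ∷ 1 ∷ 2 ∷ []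
p0120 = 0 ∷ 1 ∷ 2 ∷ 0 ∷ []
p0121 = 0 ∷ 1 ∷ 2 ∷ 1 ∷ []

Is0101 Is0102 Is0112 Is0120 Is0121 : ℕ → ℕ → ℕ → ℕ → Set
Is0101 a b c d = a < b × c ≡ a × d ≡ b
Is0102 a b c d = a < b × c ≡ a × b < d
Is0112 a b c d = a < b × c ≡ b × b < d
Is0120 a b c d = a < b × b < c × d ≡ a
Is0121 a b c d = a < b × b < c × d ≡ b

module FourLetters (a b c d : ℕ) where

  abcd : List ℕ
  abcd = a ∷ b ∷ c ∷ d ∷ []

  rk : ℕ → ℕ
  rk = letterRank abcd

  ranks : ∀ {p₁ p₂ p₃ p₄} → red abcd ≡ p₁ ∷ p₂ ∷ p₃ ∷ p₄ ∷ [] →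
          rk a ≡ p₁ × rk b ≡ p₂ × rk c ≡ p₃ × rk d ≡ p₄
  ranks e with ∷-injective e
  ... | e₁ , e′ with ∷-injective e′
  ... | e₂ , e″ with ∷-injective e″
  ... | e₃ , e‴ = e₁ , e₂ , e₃ , ∷-injectiveˡ e‴

  lt : ∀ {x y i j} → rk x ≡ i → rk y ≡ j → i < j → x < y
  lt refl refl = letterRank-<⁻ abcd

  eq : ∀ {x y i} → x ∈ abcd → y ∈ abcd → rk x ≡ i → rk y ≡ i → x ≡ y
  eq x∈ y∈ rx ry = letterRank-injective abcd x∈ y∈ (trans rx (sym ry))

  a∈ : a ∈ abcd
  a∈ = here refl
  b∈ : b ∈ abcd
  b∈ = there (here refl)
  c∈ : c ∈ abcd
  c∈ = there (there (here refl))
  d∈ : d ∈ abcd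
  d∈ = there (there (there (here refl)))

red≡0101⇒ : ∀ {a b c d} → red (a ∷ b ∷ c ∷ d ∷ []) ≡ p0101 → Is0101 a b c d
red≡0101⇒ {a} {b} {c} {d} e =
  let ra , rb , rc , rd = ranks e in
  lt ra rb (s≤s z≤n) , eq c∈ a∈ rc ra , eq d∈ b∈ rd rb
  where open FourLetters a b c d

red≡0102⇒ : ∀ {a b c d} → red (a ∷ b ∷ c ∷ d ∷ []) ≡ p0102 → Is0102 a b c d
red≡0102⇒ {a} {b} {c} {d} e =
  let ra , rb , rc , rd = ranks e in
  lt ra rb (s≤s z≤n) , eq c∈ a∈ rc ra , lt rb rd (s≤s (s≤s z≤n))
  where open FourLetters a b c d

red≡0112⇒ : ∀ {a b c d} → red (a ∷ b ∷ c ∷ d ∷ []) ≡ p0112 → Is0112 a b c d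
red≡0112⇒ {a} {b} {c} {d} e =
  let ra , rb , rc , rd = ranks e in
  lt ra rb (s≤s z≤n) , eq c∈ b∈ rc rb , lt rb rd (s≤s (s≤s z≤n))
  where open FourLetters a b c d

red≡0120⇒ : ∀ {a b c d} → red (a ∷ b ∷ c ∷ d ∷ []) ≡ p0120 → Is0120 a b c d
red≡0120⇒ {a} {b} {c} {d} e =
  let ra , rb , rc , rd = ranks e in
  lt ra rb (s≤s z≤n) , lt rb rc (s≤s (s≤s z≤n)) , eq d∈ a∈ rd ra
  where open FourLetters a b c d

red≡0121⇒ : ∀ {a b c d} → red (a ∷ b ∷ c ∷ d ∷ []) ≡ p0121 → Is0121 a b c d
red≡0121⇒ {a} {b} {c} {d} e =
  let ra , rb , rc , rd = ranks e in
  lt ra rb (s≤s z≤n) , lt rb rc (s≤s (s≤s z≤n)) , eq d∈ b∈ rd rb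
  where open FourLetters a b c d

Is0101⇒red : ∀ {a b c d} → Is0101 a b c d → red (a ∷ b ∷ c ∷ d ∷ []) ≡ p0101
Is0101⇒red {a} {b} (a<b , refl , refl) = red-stretch (a ∷ b ∷ a ∷ b ∷ []) p0101 a<b (n<1+n b) refl

Is0102⇒red : ∀ {a b c d} → Is0102 a b c d → red (a ∷ b ∷ c ∷ d ∷ []) ≡ p0102
Is0102⇒red {a} {b} {d = d} (a<b , refl , b<d) = red-stretch (a ∷ b ∷ a ∷ d ∷ []) p0102 a<b b<d refl

Is0112⇒red : ∀ {a b c d} → Is0112 a b c d → red (a ∷ b ∷ c ∷ d ∷ []) ≡ p0112
Is0112⇒red {a} {b} {d = d} (a<b , refl , b<d) = red-stretch (a ∷ b ∷ b ∷ d ∷ []) p0112 a<b b<d refl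

Is0120⇒red : ∀ {a b c d} → Is0120 a b c d → red (a ∷ b ∷ c ∷ d ∷ []) ≡ p0120
Is0120⇒red {a} {b} {c} (a<b , b<c , refl) = red-stretch (a ∷ b ∷ c ∷ a ∷ []) p0120 a<b b<c refl

Is0121⇒red : ∀ {a b c d} → Is0121 a b c d → red (a ∷ b ∷ c ∷ d ∷ []) ≡ p0121
Is0121⇒red {a} {b} {c} (a<b , b<c , refl) = red-stretch (a ∷ b ∷ c ∷ b ∷ []) p0121 a<b b<c refl

record FourLetterPattern : Set₁ where
  field
    word            : List ℕ
    IsOccurrence    : ℕ → ℕ → ℕ → ℕ → Set
    occurrence⇒red  : ∀ {a b c d} → IsOccurrence a b c d → red (a ∷ b ∷ c ∷ d ∷ []) ≡ word
    red⇒occurrence  : ∀ {a b c d} → red (a ∷ b ∷ c ∷ d ∷ []) ≡ word → IsOccurrence a b c d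
    word-length     : length word ≡ 4

open FourLetterPattern

pat0101 pat0102 pat0112 pat0120 pat0121 : FourLetterPattern
pat0101 = record
  { word = p0101 ; IsOccurrence = Is0101 ; occurrence⇒red = Is0101⇒red ; red⇒occurrence = red≡0101⇒ ; word-length = refl }
pat0102 = record
  { word = p0102 ; IsOccurrence = Is0102 ; occurrence⇒red = Is0102⇒red ; red⇒occurrence = red≡0102⇒ ; word-length = refl }
pat0112 = record
  { word = p0112 ; IsOccurrence = Is0112 ; occurrence⇒red = Is0112⇒red ; red⇒occurrence = red≡0112⇒ ; word-length = refl }
pat0120 = record
  { word = p0120 ; IsOccurrence = Is0120 ; occurrence⇒red = Is0120⇒red ; red⇒occurrence = red≡0120⇒ ; word-length = refl }
pat0121 = record
  { word = p0121 ; IsOccurrence = Is0121 ; occurrence⇒red = Is0121⇒red ; red⇒occurrence = red≡0121⇒ ; word-length = refl }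

NoEnding : (ℕ → ℕ → ℕ → ℕ → Set) → List ℕ → ℕ → Set
NoEnding R u d = ∀ {a b c} → Sub₃ a b c u → ¬ R a b c d

avoids-∷ʳ : ∀ π {u d} → Avoids u (word π) → NoEnding (IsOccurrence π) u d → Avoids (u ∷ʳ d) (word π)
avoids-∷ʳ π {u} {d} avoids noEnding (s , s⊑ud , red≡p) with subseq-∷ʳ⁻ u d s⊑ud
... | inj₁ s⊑u = avoids (s , s⊑u , red≡p)
... | inj₂ (s′ , refl , s′⊑u) = ending s′ s′⊑u red≡p length-s′
  where
  length-s′ : length s′ ≡ 3
  length-s′ = suc-injective (begin
    suc (length s′)         ≡⟨ +-comm 1 (length s′) ⟩
    length s′ + 1           ≡⟨ length-++ s′ ⟨
    length (s′ ∷ʳ d)        ≡⟨ length-map (letterRank (s′ ∷ʳ d)) (s′ ∷ʳ d) ⟨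
    length (red (s′ ∷ʳ d))  ≡⟨ cong length red≡p ⟩
    length (word π)         ≡⟨ word-length π ⟩
    4                       ∎)
    where open ≡-Reasoning
  ending : ∀ s′ → Subseq s′ u → red (s′ ∷ʳ d) ≡ word π → length s′ ≡ 3 → ⊥
  ending (_ ∷ _ ∷ _ ∷ []) abc⊑u red≡p _ = noEnding abc⊑u (red⇒occurrence π red≡p)
  ending [] _ _ ()
  ending (_ ∷ []) _ _ ()
  ending (_ ∷ _ ∷ []) _ _ ()
  ending (_ ∷ _ ∷ _ ∷ _ ∷ _) _ _ ()

contains-∷ʳ : ∀ π {u a b c d} → Sub₃ a b c u → IsOccurrence π a b c d → Contains (u ∷ʳ d) (word π)
contains-∷ʳ π abc⊑u occ = _ , keepLast _ abc⊑u , occurrence⇒red π occ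

contains-++ : ∀ {u p} v → Contains u p → Contains (u ++ v) p
contains-++ v (s , s⊑u , red≡p) = s , subseq-++ʳ v s⊑u , red≡p

singleton-avoids : ∀ {x a b p} → Avoids (x ∷ []) (a ∷ b ∷ p)
singleton-avoids (_ , skip _ done , ())
singleton-avoids (_ , keep _ done , ())

-- Counting

2^n∸n-step : ∀ L {x y z} → z ≡ x + y → x + 1 ≡ 2 ^ suc L → y + suc L ≡ 2 ^ suc L → z + suc (suc L) ≡ 2 ^ suc (suc L)
2^n∸n-step L {x} {y} refl x+1≡ y+L≡ = begin
  x + y + suc (suc L)              ≡⟨ regroup x y L ⟩
  (x + 1) + ((y + suc L) + 0)      ≡⟨ cong₂ (λ a b → a + (b + 0)) x+1≡ y+L≡ ⟩
  2 ^ suc L + (2 ^ suc L + 0)      ∎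
  where
  open ≡-Reasoning
  regroup : ∀ x y l → x + y + suc (suc l) ≡ (x + 1) + ((y + suc l) + 0)
  regroup = solve-∀

2^n∸1-step : ∀ L {x y z} → z ≡ x + (y + 1) → x + 1 ≡ 2 ^ suc L → y + 1 ≡ 2 ^ suc L → z + 1 ≡ 2 ^ suc (suc L)
2^n∸1-step L {x} {y} refl x+1≡ y+1≡ = begin
  x + (y + 1) + 1              ≡⟨ regroup x y ⟩
  (x + 1) + ((y + 1) + 0)      ≡⟨ cong₂ (λ a b → a + (b + 0)) x+1≡ y+1≡ ⟩
  2 ^ suc L + (2 ^ suc L + 0)  ∎
  where
  open ≡-Reasoning
  regroup : ∀ x y → x + (y + 1) + 1 ≡ (x + 1) + ((y + 1) + 0)
  regroup = solve-∀

2^n∸n-recurrence : ∀ (f g : ℕ → ℕ) → f 0 ≡ 1 → (∀ L → f (suc L) ≡ g L + f L) →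
                   (∀ L → g L + 1 ≡ 2 ^ suc L) → ∀ L → f L + suc L ≡ 2 ^ suc L
2^n∸n-recurrence f g f0≡1 f-suc g≡ zero = cong (_+ 1) f0≡1
2^n∸n-recurrence f g f0≡1 f-suc g≡ (suc L) = 2^n∸n-step L (f-suc L) (g≡ L) (2^n∸n-recurrence f g f0≡1 f-suc g≡ L)

rowPrefixSum : ℕ → ℕ → ℕ
rowPrefixSum n zero = 1
rowPrefixSum n (suc j) = rowPrefixSum n j + n C suc j

rowPrefixSum-pascal : ∀ n j → rowPrefixSum (suc n) (suc j) ≡ rowPrefixSum n (suc j) + rowPrefixSum n j
rowPrefixSum-pascal n zero = begin
  1 + suc n C 1      ≡⟨ cong (1 +_) (nCk+nC[k+1]≡[n+1]C[k+1] n 0) ⟨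
  1 + (1 + n C 1)    ≡⟨ +-comm 1 (1 + n C 1) ⟩
  1 + n C 1 + 1      ∎
  where open ≡-Reasoning
rowPrefixSum-pascal n (suc j) = begin
  rowPrefixSum (suc n) (suc j) + suc n C suc (suc j)
    ≡⟨ cong₂ _+_ (rowPrefixSum-pascal n j) (sym (nCk+nC[k+1]≡[n+1]C[k+1] n (suc j))) ⟩
  (rowPrefixSum n (suc j) + rowPrefixSum n j) + (n C suc j + n C suc (suc j))
    ≡⟨ interchange (rowPrefixSum n (suc j)) (rowPrefixSum n j) (n C suc j) (n C suc (suc j)) ⟩
  (rowPrefixSum n (suc j) + n C suc (suc j)) + (rowPrefixSum n j + n C suc j)
    ∎
  where
  open ≡-Reasoning
  interchange : ∀ a b x y → a + b + (x + y) ≡ a + y + (b + x)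
  interchange = solve-∀

rowPrefixSum-full : ∀ n → rowPrefixSum n n ≡ 2 ^ n
rowPrefixSum-full zero = refl
rowPrefixSum-full (suc n) = begin
  rowPrefixSum (suc n) (suc n)                     ≡⟨ rowPrefixSum-pascal n n ⟩
  rowPrefixSum n n + n C suc n + rowPrefixSum n n
    ≡⟨ cong (λ z → rowPrefixSum n n + z + rowPrefixSum n n) (k>n⇒nCk≡0 (n<1+n n)) ⟩
  rowPrefixSum n n + 0 + rowPrefixSum n n
    ≡⟨ cong₂ _+_ (+-identityʳ (rowPrefixSum n n)) (sym (+-identityʳ (rowPrefixSum n n))) ⟩
  rowPrefixSum n n + (rowPrefixSum n n + 0)
    ≡⟨ cong (λ z → z + (z + 0)) (rowPrefixSum-full n) ⟩
  2 ^ n + (2 ^ n + 0)                              ∎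
  where open ≡-Reasoning

-- Generating trees

-- An ascent sequence 0 ∷ t is handled through its tail t.
Good : List (List ℕ) → List ℕ → Set
Good P t = AscentTail t × All (Avoids (0 ∷ t)) P

good-++⁻ : ∀ P t v → Good P (t ++ v) → Good P t
good-++⁻ P t v (tail , avoids) = admissible-++⁻ 0 0 t v tail , All.map (λ av → av ∘ contains-++ v) avoids

good-∷ʳ⇒bound : ∀ {P t d} → Good P (t ∷ʳ d) → d ≤ suc (asc (0 ∷ t))
good-∷ʳ⇒bound {t = t} (tail , _) = admissible-∷ʳ⁻ 0 0 t tail

good⇒last≤ : ∀ {P t l} → Good P t → lastOr 0 t ≡ l → l ≤ suc (asc (0 ∷ t))
good⇒last≤ {t = t} (tail , _) refl = lastOr≤suc-ascents 0 0 t z≤n tail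

good₃-∷ʳ : ∀ π₁ π₂ π₃ {t d} → Good (word π₁ ∷ word π₂ ∷ word π₃ ∷ []) t → d ≤ suc (asc (0 ∷ t)) →
           NoEnding (IsOccurrence π₁) (0 ∷ t) d → NoEnding (IsOccurrence π₂) (0 ∷ t) d →
           NoEnding (IsOccurrence π₃) (0 ∷ t) d →
           Good (word π₁ ∷ word π₂ ∷ word π₃ ∷ []) (t ∷ʳ d)
good₃-∷ʳ π₁ π₂ π₃ {t} (tail , av₁ ∷ av₂ ∷ av₃ ∷ []) d≤ no₁ no₂ no₃ =
  admissible-∷ʳ⁺ 0 0 t tail d≤ ,
  avoids-∷ʳ π₁ av₁ no₁ ∷ avoids-∷ʳ π₂ av₂ no₂ ∷ avoids-∷ʳ π₃ av₃ no₃ ∷ []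

record GeneratingTree (P : List (List ℕ)) : Set₁ where
  field
    State           : Set
    root            : State
    allowed         : State → List ℕ
    next            : State → ℕ → State
    Inv             : State → List ℕ → Set
    allowed-unique  : ∀ σ → Unique (allowed σ)
    root-inv        : Inv root []
    root-good       : Good P []
    grow            : ∀ σ t d → Inv σ t → Good P t → d ∈ allowed σ → Good P (t ∷ʳ d) × Inv (next σ d) (t ∷ʳ d)
    complete        : ∀ σ t d → Inv σ t → Good P t → Good P (t ∷ʳ d) → d ∈ allowed σ

module Enumeration {P : List (List ℕ)} (T : GeneratingTree P) where

  open GeneratingTree T

  mutual
    level : State → ℕ → List (List ℕ)
    level σ zero = [] ∷ []
    level σ (suc L) = branches σ L (allowed σ)

    branches : State → ℕ → List ℕ → List (List ℕ)
    branches σ L [] = []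
    branches σ L (d ∷ ds) = map (d ∷_) (level (next σ d) L) ++ branches σ L ds

  size : State → ℕ → ℕ
  size σ L = length (level σ L)

  branches⁻ : ∀ σ L ds {x} → x ∈ branches σ L ds →
              ∃ λ d → ∃ λ x′ → d ∈ ds × x ≡ d ∷ x′ × x′ ∈ level (next σ d) L
  branches⁻ σ L (d ∷ ds) x∈ with ∈-++⁻ (map (d ∷_) (level (next σ d) L)) x∈
  ... | inj₁ x∈map with ∈-map⁻ (d ∷_) x∈map
  ...   | x′ , x′∈ , refl = d , x′ , here refl , refl , x′∈
  branches⁻ σ L (d ∷ ds) x∈ | inj₂ x∈rest with branches⁻ σ L ds x∈rest
  ...   | d′ , x′ , d′∈ , refl , x′∈ = d′ , x′ , there d′∈ , refl , x′∈

  branches⁺ : ∀ σ L ds {d x′} → d ∈ ds → x′ ∈ level (next σ d) L → d ∷ x′ ∈ branches σ L ds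
  branches⁺ σ L (d ∷ ds) (here refl) x′∈ = ∈-++⁺ˡ (∈-map⁺ (d ∷_) x′∈)
  branches⁺ σ L (d ∷ ds) (there d∈) x′∈ = ∈-++⁺ʳ (map (d ∷_) (level (next σ d) L)) (branches⁺ σ L ds d∈ x′∈)

  mutual
    level-unique : ∀ σ L → Unique (level σ L)
    level-unique σ zero = [] ∷ []
    level-unique σ (suc L) = branches-unique σ L (allowed σ) (allowed-unique σ)

    branches-unique : ∀ σ L ds → Unique ds → Unique (branches σ L ds)
    branches-unique σ L [] _ = []
    branches-unique σ L (d ∷ ds) (d∉ds ∷ ds-unique) =
      Unique.++⁺ (Unique.map⁺ ∷-injectiveʳ (level-unique (next σ d) L)) (branches-unique σ L ds ds-unique) disjoint
      where
      disjoint : ∀ {x} → ¬ (x ∈ map (d ∷_) (level (next σ d) L) × x ∈ branches σ L ds)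
      disjoint (x∈map , x∈rest) with ∈-map⁻ (d ∷_) x∈map | branches⁻ σ L ds x∈rest
      ... | _ , _ , refl | _ , _ , d′∈ds , e , _ = All.lookup d∉ds d′∈ds (∷-injectiveˡ e)

  level-length : ∀ σ L {x} → x ∈ level σ L → length x ≡ L
  level-length σ zero (here refl) = refl
  level-length σ (suc L) x∈ with branches⁻ σ L (allowed σ) x∈
  ... | d , x′ , _ , refl , x′∈ = cong suc (level-length (next σ d) L x′∈)

  level-sound : ∀ σ L t {x} → Inv σ t → Good P t → x ∈ level σ L → Good P (t ++ x)
  level-sound σ zero t inv good (here refl) = subst (Good P) (sym (++-identityʳ t)) good
  level-sound σ (suc L) t inv good x∈ with branches⁻ σ L (allowed σ) x∈
  ... | d , x′ , d∈ , refl , x′∈ with grow σ t d inv good d∈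
  ...   | good′ , inv′ = subst (Good P) (++-assoc t (d ∷ []) x′) (level-sound (next σ d) L (t ∷ʳ d) inv′ good′ x′∈)

  level-complete : ∀ σ t x → Inv σ t → Good P t → Good P (t ++ x) → x ∈ level σ (length x)
  level-complete σ t [] inv good _ = here refl
  level-complete σ t (d ∷ x′) inv good good-tx =
    branches⁺ σ _ (allowed σ) d∈ (level-complete (next σ d) (t ∷ʳ d) x′ (proj₂ grown) (proj₁ grown) good-tdx)
    where
    good-tdx : Good P ((t ∷ʳ d) ++ x′)
    good-tdx = subst (Good P) (sym (++-assoc t (d ∷ []) x′)) good-tx
    d∈ : d ∈ allowed σ
    d∈ = complete σ t d inv good (good-++⁻ P (t ∷ʳ d) x′ good-tdx)
    grown : Good P (t ∷ʳ d) × Inv (next σ d) (t ∷ʳ d)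
    grown = grow σ t d inv good d∈

  hasCount : ∀ n → HasCount (suc n) P (size root n)
  hasCount n = map (0 ∷_) (level root n) , Unique.map⁺ ∷-injectiveʳ (level-unique root n) ,
               (λ x → mk⇔ (sound x) (complete′ x)) , length-map (0 ∷_) (level root n)
    where
    sound : ∀ x → x ∈ map (0 ∷_) (level root n) → InA (suc n) P x
    sound x x∈ with ∈-map⁻ (0 ∷_) x∈
    ... | t , t∈ , refl with level-sound root n [] root-inv root-good t∈
    ...   | tail , avoids = ascentTail⇒IsAscentSeq t tail , cong suc (level-length root n t∈) , All.lookup avoids
    complete′ : ∀ x → InA (suc n) P x → x ∈ map (0 ∷_) (level root n)
    complete′ (y ∷ t) (isAsc , refl , avoids) with IsAscentSeq⇒ascentTail y t isAsc
    ... | refl , tail = ∈-map⁺ (0 ∷_) (level-complete root [] t root-inv root-good (tail , All.tabulate avoids))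

  size-suc : ∀ σ L → size σ (suc L) ≡ sum (map (λ d → size (next σ d) L) (allowed σ))
  size-suc σ L = go (allowed σ)
    where
    go : ∀ ds → length (branches σ L ds) ≡ sum (map (λ d → size (next σ d) L) ds)
    go [] = refl
    go (d ∷ ds) = begin
      length (map (d ∷_) (level (next σ d) L) ++ branches σ L ds)        ≡⟨ length-++ (map (d ∷_) (level (next σ d) L)) ⟩
      length (map (d ∷_) (level (next σ d) L)) + length (branches σ L ds)
        ≡⟨ cong₂ _+_ (length-map (d ∷_) (level (next σ d) L)) (go ds) ⟩
      size (next σ d) L + sum (map (λ d → size (next σ d) L) ds)          ∎
      where open ≡-Reasoning

  size-root+n≡2^n : ∀ σ → (∀ L → size root (suc L) ≡ size σ L + size root L) → (∀ L → size σ L + 1 ≡ 2 ^ suc L) →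
                    ∀ L → size root L + suc L ≡ 2 ^ suc L
  size-root+n≡2^n σ = 2^n∸n-recurrence (size root) (size σ) refl

  hasCount-2^n∸n : (∀ L → size root L + suc L ≡ 2 ^ suc L) → ∀ n → 1 ≤ n → HasCount n P (2 ^ n ∸ n)
  hasCount-2^n∸n size≡ (suc L) _ = subst (HasCount (suc L) P) size≡2^n∸n (hasCount L)
    where
    size≡2^n∸n : size root L ≡ 2 ^ suc L ∸ suc L
    size≡2^n∸n = trans (sym (m+n∸n≡m (size root L) (suc L))) (cong (_∸ suc L) (size≡ L))

-- Invariants of the generating trees

Bounded : ℕ → List ℕ → Set
Bounded m u = ∀ x → Sub₁ x u → x ≤ m

bounded-∷ʳ : ∀ {m u d} → Bounded m u → d ≤ m → Bounded m (u ∷ʳ d)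
bounded-∷ʳ {u = u} {d} bounded d≤m x occ with Sub₁-∷ʳ⁻ u d occ
... | inj₁ occ′ = bounded x occ′
... | inj₂ refl = d≤m

bounded-weaken : ∀ {m m′ u} → m ≤ m′ → Bounded m u → Bounded m′ u
bounded-weaken m≤m′ bounded x occ = ≤-trans (bounded x occ) m≤m′

[0]-bounded : Bounded 0 (0 ∷ [])
[0]-bounded _ (keep _ done) = z≤n

bounded⇒∉ : ∀ {m u d} → Bounded m u → m < d → ¬ Sub₁ d u
bounded⇒∉ bounded m<d occ = <⇒≱ m<d (bounded _ occ)

Sub₁-head : ∀ x t → Sub₁ x (x ∷ t)
Sub₁-head x t = keep x (subseq-[] t)

NonDecreasing : List ℕ → Set
NonDecreasing u = ∀ x y → Sub₂ x y u → x ≤ y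

nonDecreasing-∷ʳ : ∀ {u d} → NonDecreasing u → Bounded d u → NonDecreasing (u ∷ʳ d)
nonDecreasing-∷ʳ {u} {d} nonDec bounded x y occ with Sub₂-∷ʳ⁻ u d occ
... | inj₁ occ′ = nonDec x y occ′
... | inj₂ (occ′ , refl) = bounded x occ′

bounded⇒nonDecreasing : ∀ {u} → Bounded 0 u → NonDecreasing u
bounded⇒nonDecreasing bounded x y occ with bounded x (Sub₂⇒Sub₁ˡ occ)
... | z≤n = z≤n

nonDecreasing⇒¬0101 : ∀ {u d} → NonDecreasing u → NoEnding Is0101 u d
nonDecreasing⇒¬0101 nonDec occ (a<b , refl , _) = <⇒≱ a<b (nonDec _ _ (Sub₃⇒Sub₂ʳ occ))

nonDecreasing⇒¬0102 : ∀ {u d} → NonDecreasing u → NoEnding Is0102 u d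
nonDecreasing⇒¬0102 nonDec occ (a<b , refl , _) = <⇒≱ a<b (nonDec _ _ (Sub₃⇒Sub₂ʳ occ))

bounded⇒¬0120 : ∀ {u d} → Bounded (suc d) u → NoEnding Is0120 u d
bounded⇒¬0120 bounded occ (a<b , b<c , refl) =
  <⇒≱ (<-≤-trans (s≤s a<b) b<c) (bounded _ (Sub₂⇒Sub₁ʳ (Sub₃⇒Sub₂ʳ occ)))

bounded⇒¬0121 : ∀ {u d} → Bounded d u → NoEnding Is0121 u d
bounded⇒¬0121 bounded occ (_ , b<c , refl) = <⇒≱ b<c (bounded _ (Sub₂⇒Sub₁ʳ (Sub₃⇒Sub₂ʳ occ)))

2≤top : ∀ {a b c} → a < b → b < c → 2 ≤ c
2≤top a<b b<c = ≤-trans (s≤s (s≤s z≤n)) (<-≤-trans (s≤s a<b) b<c)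

binary⇒¬0121 : ∀ {u d} → Bounded 1 u → NoEnding Is0121 u d
binary⇒¬0121 bounded occ (a<b , b<c , _) = <⇒≱ (2≤top a<b b<c) (bounded _ (Sub₂⇒Sub₁ʳ (Sub₃⇒Sub₂ʳ occ)))

≤1⇒¬0102 : ∀ {u d} → d ≤ 1 → NoEnding Is0102 u d
≤1⇒¬0102 d≤1 _ (a<b , _ , b<d) = <⇒≱ (2≤top a<b b<d) d≤1

0⇒¬0101 : ∀ {u} → NoEnding Is0101 u 0
0⇒¬0101 _ (() , _ , refl)

0⇒¬0102 : ∀ {u} → NoEnding Is0102 u 0
0⇒¬0102 _ (_ , _ , ())

0⇒¬0112 : ∀ {u} → NoEnding Is0112 u 0
0⇒¬0112 _ (_ , _ , ())

0⇒¬0121 : ∀ {u} → NoEnding Is0121 u 0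
0⇒¬0121 _ (() , _ , refl)

fresh⇒¬0101 : ∀ {u d} → ¬ Sub₁ d u → NoEnding Is0101 u d
fresh⇒¬0101 d∉u occ (_ , _ , refl) = d∉u (Sub₂⇒Sub₁ʳ (Sub₃⇒Sub₂ˡ occ))

fresh⇒¬0120 : ∀ {u d} → ¬ Sub₁ d u → NoEnding Is0120 u d
fresh⇒¬0120 d∉u occ (_ , _ , refl) = d∉u (Sub₂⇒Sub₁ˡ (Sub₃⇒Sub₂ˡ occ))

fresh⇒¬0121 : ∀ {u d} → ¬ Sub₁ d u → NoEnding Is0121 u d
fresh⇒¬0121 d∉u occ (_ , _ , refl) = d∉u (Sub₂⇒Sub₁ʳ (Sub₃⇒Sub₂ˡ occ))

module Avoid-0101-0102-0112 where

  P : List (List ℕ)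
  P = p0101 ∷ p0102 ∷ p0112 ∷ []

  -- rising m: the sequence is 0⋯0 1 2 ⋯ m.  falling w: a rising prefix followed by a
  -- weakly decreasing run, the last letter being w.
  data State : Set where
    rising falling : ℕ → State

  allowed : State → List ℕ
  allowed (rising m) = suc m ∷ downFrom (suc m)
  allowed (falling w) = downFrom (suc w)

  next : State → ℕ → State
  next (rising zero) zero = rising zero
  next (rising zero) (suc _) = rising 1
  next (rising (suc k)) d = if suc k <ᵇ d then rising d else falling d
  next (falling _) d = falling d

  next-rise : ∀ k → next (rising (suc k)) (suc (suc k)) ≡ rising (suc (suc k))
  next-rise k rewrite <ᵇ-true (n<1+n (suc k)) = refl

  next-fall : ∀ {k d} → d ≤ suc k → next (rising (suc k)) d ≡ falling d
  next-fall d≤ rewrite <ᵇ-false d≤ = refl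

  allowed-unique : ∀ σ → Unique (allowed σ)
  allowed-unique (rising m) = All.tabulate (λ d∈ e → <-irrefl (sym e) (∈-downFrom⁻ d∈)) ∷ Unique.downFrom⁺ (suc m)
  allowed-unique (falling w) = Unique.downFrom⁺ (suc w)

  Inv : State → List ℕ → Set
  Inv (rising m) t =
    asc (0 ∷ t) ≡ m × lastOr 0 t ≡ m × Bounded m (0 ∷ t) × NonDecreasing (0 ∷ t) ×
    (∀ b → Sub₂ b b (0 ∷ t) → b ≡ 0) × (∀ d → 1 ≤ d → d ≤ m → Sub₂ 0 d (0 ∷ t))
  Inv (falling w) t =
    lastOr 0 t ≡ w × (∀ x y → Sub₂ x y (0 ∷ t) → y < x → w ≤ y) ×
    (∀ b → Sub₂ b b (0 ∷ t) → 1 ≤ b → w ≤ b) × (∀ d → 1 ≤ d → d ≤ w → Sub₂ 0 d (0 ∷ t)) ×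
    (1 ≤ w → Sub₃ 0 w w (0 ∷ t)) × (w ≡ 0 → Sub₃ 0 1 0 (0 ∷ t))

  root-inv : Inv (rising 0) []
  root-inv = refl , refl , [0]-bounded , bounded⇒nonDecreasing [0]-bounded ,
             (λ b occ → n≤0⇒n≡0 ([0]-bounded b (Sub₂⇒Sub₁ˡ occ))) , (λ d 1≤d d≤0 → ⊥-elim (<⇒≱ 1≤d d≤0))

  extend : ∀ {t d} → Good P t → d ≤ suc (asc (0 ∷ t)) →
           NoEnding Is0101 (0 ∷ t) d → NoEnding Is0102 (0 ∷ t) d → NoEnding Is0112 (0 ∷ t) d → Good P (t ∷ʳ d)
  extend = good₃-∷ʳ pat0101 pat0102 pat0112

  rising-good : ∀ {m t d} → Inv (rising m) t → Good P t → d ≤ suc m → Good P (t ∷ʳ d)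
  rising-good {t = t} {d} (asc≡ , _ , _ , nonDec , repeats , _) good d≤ =
    extend good (≤suc-≡ (sym asc≡) d≤) (nonDecreasing⇒¬0101 nonDec) (nonDecreasing⇒¬0102 nonDec) no0112
    where
    no0112 : NoEnding Is0112 (0 ∷ t) d
    no0112 occ (a<b , refl , _) = n≮0 (subst (_ <_) (repeats _ (Sub₃⇒Sub₂ʳ occ)) a<b)

  rising-rise : ∀ {m t} → Inv (rising m) t → Inv (rising (suc m)) (t ∷ʳ suc m)
  rising-rise {m} {t} (asc≡ , last≡ , bounded , nonDec , repeats , reached) =
    trans (asc-∷ʳ-rise t (s≤s (≤-reflexive last≡))) (cong suc asc≡) , lastOr-∷ʳ 0 t (suc m) ,
    bounded-∷ʳ bounded′ ≤-refl , nonDecreasing-∷ʳ nonDec bounded′ , repeats′ , reached′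
    where
    bounded′ : Bounded (suc m) (0 ∷ t)
    bounded′ = bounded-weaken (n≤1+n m) bounded
    repeats′ : ∀ b → Sub₂ b b ((0 ∷ t) ∷ʳ suc m) → b ≡ 0
    repeats′ b occ with Sub₂-∷ʳ⁻ (0 ∷ t) (suc m) occ
    ... | inj₁ occ′ = repeats b occ′
    ... | inj₂ (occ′ , refl) = ⊥-elim (bounded⇒∉ bounded ≤-refl occ′)
    reached′ : ∀ d → 1 ≤ d → d ≤ suc m → Sub₂ 0 d ((0 ∷ t) ∷ʳ suc m)
    reached′ d 1≤d d≤ with m≤n⇒m<n∨m≡n d≤
    ... | inj₁ d<sm = skipLast (suc m) (reached d 1≤d (≤-pred d<sm))
    ... | inj₂ refl = keepLast (suc m) (Sub₁-head 0 t)

  rising-stay : ∀ {t} → Inv (rising 0) t → Inv (rising 0) (t ∷ʳ 0)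
  rising-stay {t} (asc≡ , _ , bounded , nonDec , repeats , _) =
    trans (asc-∷ʳ-flat t z≤n) asc≡ , lastOr-∷ʳ 0 t 0 , bounded-∷ʳ bounded z≤n , nonDecreasing-∷ʳ nonDec bounded ,
    repeats′ , (λ d 1≤d d≤0 → ⊥-elim (<⇒≱ 1≤d d≤0))
    where
    repeats′ : ∀ b → Sub₂ b b ((0 ∷ t) ∷ʳ 0) → b ≡ 0
    repeats′ b occ with Sub₂-∷ʳ⁻ (0 ∷ t) 0 occ
    ... | inj₁ occ′ = repeats b occ′
    ... | inj₂ (_ , b≡0) = b≡0

  rising-fall : ∀ {k t d} → Inv (rising (suc k)) t → d ≤ suc k → Inv (falling d) (t ∷ʳ d)
  rising-fall {t = t} {d} (_ , _ , _ , nonDec , repeats , reached) d≤ =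
    lastOr-∷ʳ 0 t d , descents , repeats′ ,
    (λ d′ 1≤d′ d′≤d → skipLast d (reached d′ 1≤d′ (≤-trans d′≤d d≤))) ,
    (λ 1≤d → keepLast d (reached d 1≤d d≤)) , (λ { refl → keepLast 0 (reached 1 ≤-refl (s≤s z≤n)) })
    where
    descents : ∀ x y → Sub₂ x y ((0 ∷ t) ∷ʳ d) → y < x → d ≤ y
    descents x y occ y<x with Sub₂-∷ʳ⁻ (0 ∷ t) d occ
    ... | inj₁ occ′ = ⊥-elim (<⇒≱ y<x (nonDec x y occ′))
    ... | inj₂ (_ , refl) = ≤-refl
    repeats′ : ∀ b → Sub₂ b b ((0 ∷ t) ∷ʳ d) → 1 ≤ b → d ≤ b
    repeats′ b occ 1≤b with Sub₂-∷ʳ⁻ (0 ∷ t) d occ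
    ... | inj₁ occ′ = ⊥-elim (<⇒≢ 1≤b (sym (repeats b occ′)))
    ... | inj₂ (_ , refl) = ≤-refl

  falling-reached-1 : ∀ {w t} → Inv (falling w) t → Sub₂ 0 1 (0 ∷ t)
  falling-reached-1 {zero} (_ , _ , _ , _ , _ , dip) = Sub₃⇒Sub₂ˡ (dip refl)
  falling-reached-1 {suc _} (_ , _ , _ , reached , _ , _) = reached 1 ≤-refl (s≤s z≤n)

  falling-step : ∀ {w t d} → Inv (falling w) t → Good P t → d ≤ w → Good P (t ∷ʳ d) × Inv (falling d) (t ∷ʳ d)
  falling-step {t = t} {d} inv@(last≡ , descents , repeats , reached , _ , _) good d≤w =
    extend good (≤-trans d≤w (good⇒last≤ good last≡)) no0101 no0102 no0112 ,
    lastOr-∷ʳ 0 t d , descents′ , repeats′ ,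
    (λ d′ 1≤d′ d′≤d → skipLast d (reached d′ 1≤d′ (≤-trans d′≤d d≤w))) ,
    (λ 1≤d → keepLast d (reached d 1≤d d≤w)) , (λ { refl → keepLast 0 (falling-reached-1 inv) })
    where
    no0101 : NoEnding Is0101 (0 ∷ t) d
    no0101 occ (a<b , refl , refl) = <⇒≱ a<b (≤-trans d≤w (descents _ _ (Sub₃⇒Sub₂ʳ occ) a<b))
    no0102 : NoEnding Is0102 (0 ∷ t) d
    no0102 occ (a<b , refl , b<d) = <⇒≱ (<-trans a<b b<d) (≤-trans d≤w (descents _ _ (Sub₃⇒Sub₂ʳ occ) a<b))
    no0112 : NoEnding Is0112 (0 ∷ t) d
    no0112 occ (a<b , refl , b<d) = <⇒≱ b<d (≤-trans d≤w (repeats _ (Sub₃⇒Sub₂ʳ occ) (≤-trans (s≤s z≤n) a<b)))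
    descents′ : ∀ x y → Sub₂ x y ((0 ∷ t) ∷ʳ d) → y < x → d ≤ y
    descents′ x y occ y<x with Sub₂-∷ʳ⁻ (0 ∷ t) d occ
    ... | inj₁ occ′ = ≤-trans d≤w (descents x y occ′ y<x)
    ... | inj₂ (_ , refl) = ≤-refl
    repeats′ : ∀ b → Sub₂ b b ((0 ∷ t) ∷ʳ d) → 1 ≤ b → d ≤ b
    repeats′ b occ 1≤b with Sub₂-∷ʳ⁻ (0 ∷ t) d occ
    ... | inj₁ occ′ = ≤-trans d≤w (repeats b occ′ 1≤b)
    ... | inj₂ (_ , refl) = ≤-refl

  falling-blocked : ∀ w d {t} → Inv (falling w) t → Good P (t ∷ʳ d) → w < d → ⊥
  falling-blocked (suc w) d (_ , _ , _ , _ , peak , _) (_ , _ ∷ _ ∷ av₃ ∷ []) w<d =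
    av₃ (contains-∷ʳ pat0112 (peak (s≤s z≤n)) (s≤s z≤n , refl , w<d))
  falling-blocked zero (suc zero) (_ , _ , _ , _ , _ , dip) (_ , av₁ ∷ _ ∷ _ ∷ []) _ =
    av₁ (contains-∷ʳ pat0101 (dip refl) (s≤s z≤n , refl , refl))
  falling-blocked zero (suc (suc d)) (_ , _ , _ , _ , _ , dip) (_ , _ ∷ av₂ ∷ _ ∷ []) _ =
    av₂ (contains-∷ʳ pat0102 (dip refl) (s≤s z≤n , refl , s≤s (s≤s z≤n)))

  grow : ∀ σ t d → Inv σ t → Good P t → d ∈ allowed σ → Good P (t ∷ʳ d) × Inv (next σ d) (t ∷ʳ d)
  grow (rising zero) t .1 inv good (here refl) = rising-good inv good ≤-refl , rising-rise inv
  grow (rising zero) t .0 inv good (there (here refl)) = rising-good inv good z≤n , rising-stay inv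
  grow (rising (suc k)) t .(suc (suc k)) inv good (here refl) rewrite next-rise k =
    rising-good inv good ≤-refl , rising-rise inv
  grow (rising (suc k)) t d inv good (there d∈) rewrite next-fall (≤-pred (∈-downFrom⁻ d∈)) =
    rising-good inv good (m≤n⇒m≤1+n (≤-pred (∈-downFrom⁻ d∈))) , rising-fall inv (≤-pred (∈-downFrom⁻ d∈))
  grow (falling w) t d inv good d∈ = falling-step inv good (≤-pred (∈-downFrom⁻ d∈))

  complete : ∀ σ t d → Inv σ t → Good P t → Good P (t ∷ʳ d) → d ∈ allowed σ
  complete (rising m) t d (asc≡ , _) _ good′ with m≤n⇒m<n∨m≡n (≤suc-≡ asc≡ (good-∷ʳ⇒bound good′))
  ... | inj₁ d<sm = there (∈-downFrom⁺ d<sm)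
  ... | inj₂ refl = here refl
  complete (falling w) t d inv _ good′ with d ≤? w
  ... | yes d≤w = ∈-downFrom⁺ (s≤s d≤w)
  ... | no d≰w = ⊥-elim (falling-blocked w d inv good′ (≰⇒> d≰w))

  tree : GeneratingTree P
  tree = record
    { State = State ; root = rising 0 ; allowed = allowed ; next = next ; Inv = Inv
    ; allowed-unique = allowed-unique ; root-inv = root-inv
    ; root-good = tt , singleton-avoids ∷ singleton-avoids ∷ singleton-avoids ∷ []
    ; grow = grow ; complete = complete
    }

  open Enumeration tree

  size-falling : ∀ w L → size (falling w) L ≡ (w + L) C L
  size-falling w zero = refl
  size-falling zero (suc L) = begin
    size (falling 0) (suc L)  ≡⟨ size-suc (falling 0) L ⟩
    size (falling 0) L + 0  ≡⟨ +-identityʳ _ ⟩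
    size (falling 0) L      ≡⟨ size-falling 0 L ⟩
    L C L                   ≡⟨ nCn≡1 L ⟩
    1                       ≡⟨ nCn≡1 (suc L) ⟨
    suc L C suc L           ∎
    where open ≡-Reasoning
  size-falling (suc w) (suc L) = begin
    size (falling (suc w)) (suc L)
      ≡⟨ size-suc (falling (suc w)) L ⟩
    size (falling (suc w)) L + sum (map (λ d → size (falling d) L) (downFrom (suc w)))
      ≡⟨ cong (size (falling (suc w)) L +_) (size-suc (falling w) L) ⟨
    size (falling (suc w)) L + size (falling w) (suc L)
      ≡⟨ cong₂ _+_ (size-falling (suc w) L) (size-falling w (suc L)) ⟩
    suc (w + L) C L + (w + suc L) C suc L
      ≡⟨ cong (λ n → n C L + (w + suc L) C suc L) (+-suc w L) ⟨
    (w + suc L) C L + (w + suc L) C suc L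
      ≡⟨ nCk+nC[k+1]≡[n+1]C[k+1] (w + suc L) L ⟩
    suc (w + suc L) C suc L
      ∎
    where open ≡-Reasoning

  size-rising-suc : ∀ k L → size (rising (suc k)) (suc L) ≡ size (rising (suc (suc k))) L + size (falling (suc k)) (suc L)
  size-rising-suc k L = begin
    size (rising (suc k)) (suc L)
      ≡⟨ size-suc (rising (suc k)) L ⟩
    size (next (rising (suc k)) (suc (suc k))) L + sum (map (λ d → size (next (rising (suc k)) d) L) (downFrom (suc (suc k))))
      ≡⟨ cong₂ _+_ (cong (λ σ → size σ L) (next-rise k)) (cong sum (map-cong-local (All.tabulate falls))) ⟩
    size (rising (suc (suc k))) L + sum (map (λ d → size (falling d) L) (downFrom (suc (suc k))))
      ≡⟨ cong (size (rising (suc (suc k))) L +_) (size-suc (falling (suc k)) L) ⟨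
    size (rising (suc (suc k))) L + size (falling (suc k)) (suc L)
      ∎
    where
    open ≡-Reasoning
    falls : ∀ {d} → d ∈ downFrom (suc (suc k)) → size (next (rising (suc k)) d) L ≡ size (falling d) L
    falls d∈ = cong (λ σ → size σ L) (next-fall (≤-pred (∈-downFrom⁻ d∈)))

  size-rising : ∀ k L → size (rising (suc k)) L ≡ rowPrefixSum (suc k + L) L
  size-rising k zero = refl
  size-rising k (suc L) = begin
    size (rising (suc k)) (suc L)
      ≡⟨ size-rising-suc k L ⟩
    size (rising (suc (suc k))) L + size (falling (suc k)) (suc L)
      ≡⟨ cong₂ _+_ (size-rising (suc k) L) (size-falling (suc k) (suc L)) ⟩
    rowPrefixSum (suc (suc k) + L) L + (suc k + suc L) C suc L
      ≡⟨ cong (λ n → rowPrefixSum n L + (suc k + suc L) C suc L) (+-suc (suc k) L) ⟨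
    rowPrefixSum (suc k + suc L) (suc L)
      ∎
    where open ≡-Reasoning

  size-rising-1 : ∀ L → size (rising 1) L + 1 ≡ 2 ^ suc L
  size-rising-1 L = begin
    size (rising 1) L + 1                  ≡⟨ cong₂ _+_ (size-rising 0 L) (sym (nCn≡1 (suc L))) ⟩
    rowPrefixSum (suc L) L + suc L C suc L ≡⟨ rowPrefixSum-full (suc L) ⟩
    2 ^ suc L                              ∎
    where open ≡-Reasoning

  count : ∀ n → 1 ≤ n → HasCount n P (2 ^ n ∸ n)
  count = hasCount-2^n∸n (size-root+n≡2^n (rising 1) size-root-suc size-rising-1)
    where
    size-root-suc : ∀ L → size (rising 0) (suc L) ≡ size (rising 1) L + size (rising 0) L
    size-root-suc L = trans (size-suc (rising 0) L) (cong (size (rising 1) L +_) (+-identityʳ _))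

module Avoid-0101-0102-0120 where

  P : List (List ℕ)
  P = p0101 ∷ p0102 ∷ p0120 ∷ []

  -- climbing v: a weakly increasing sequence through all of 0, …, v, ending in v.
  -- dropped w: a climbing sequence to w + 1 followed by a run of w's.
  data State : Set where
    climbing dropped : ℕ → State

  allowed : State → List ℕ
  allowed (climbing zero) = 1 ∷ 0 ∷ []
  allowed (climbing (suc w)) = suc w ∷ suc (suc w) ∷ w ∷ []
  allowed (dropped w) = w ∷ []

  next : State → ℕ → State
  next (climbing zero) d = climbing d
  next (climbing (suc w)) d = if d <ᵇ suc w then dropped w else climbing d
  next (dropped w) _ = dropped w

  next-stay : ∀ w → next (climbing (suc w)) (suc w) ≡ climbing (suc w)
  next-stay w rewrite <ᵇ-false (≤-refl {suc w}) = refl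

  next-climb : ∀ w → next (climbing (suc w)) (suc (suc w)) ≡ climbing (suc (suc w))
  next-climb w rewrite <ᵇ-false (n≤1+n (suc w)) = refl

  next-drop : ∀ w → next (climbing (suc w)) w ≡ dropped w
  next-drop w rewrite <ᵇ-true (n<1+n w) = refl

  allowed-unique : ∀ σ → Unique (allowed σ)
  allowed-unique (climbing zero) = ((λ ()) ∷ []) ∷ [] ∷ []
  allowed-unique (climbing (suc w)) =
    ((λ e → 1+n≢n (sym e)) ∷ 1+n≢n ∷ []) ∷ ((λ e → <⇒≢ (n≤1+n (suc w)) (sym e)) ∷ []) ∷ [] ∷ []
  allowed-unique (dropped w) = [] ∷ []

  Inv : State → List ℕ → Set
  Inv (climbing v) t =
    asc (0 ∷ t) ≡ v × lastOr 0 t ≡ v × Bounded v (0 ∷ t) × NonDecreasing (0 ∷ t) ×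
    (∀ a b → a < b → b < v → Sub₃ a b v (0 ∷ t)) × (∀ a → a < v → Sub₂ a v (0 ∷ t)) × Sub₁ v (0 ∷ t)
  Inv (dropped w) t =
    lastOr 0 t ≡ w × Bounded (suc w) (0 ∷ t) × (∀ a → Sub₂ w a (0 ∷ t) → w ≤ a) ×
    (∀ x y → Sub₂ x y (0 ∷ t) → y < w → x ≤ y) × Sub₃ w (suc w) w (0 ∷ t) ×
    (∀ a → a < w → Sub₃ a w (suc w) (0 ∷ t))

  root-inv : Inv (climbing 0) []
  root-inv = refl , refl , [0]-bounded , bounded⇒nonDecreasing [0]-bounded , (λ _ _ _ ()) , (λ _ ()) , Sub₁-head 0 []

  extend : ∀ {t d} → Good P t → d ≤ suc (asc (0 ∷ t)) →
           NoEnding Is0101 (0 ∷ t) d → NoEnding Is0102 (0 ∷ t) d → NoEnding Is0120 (0 ∷ t) d → Good P (t ∷ʳ d)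
  extend = good₃-∷ʳ pat0101 pat0102 pat0120

  climbing-good : ∀ {v t d} → Inv (climbing v) t → Good P t → d ≤ suc v → Bounded (suc d) (0 ∷ t) → Good P (t ∷ʳ d)
  climbing-good (asc≡ , _ , _ , nonDec , _) good d≤ bounded =
    extend good (≤suc-≡ (sym asc≡) d≤) (nonDecreasing⇒¬0101 nonDec) (nonDecreasing⇒¬0102 nonDec) (bounded⇒¬0120 bounded)

  climbing-stay : ∀ {v t} → Inv (climbing v) t → Inv (climbing v) (t ∷ʳ v)
  climbing-stay {v} {t} (asc≡ , last≡ , bounded , nonDec , below₂ , below₁ , top) =
    trans (asc-∷ʳ-flat t (≤-reflexive (sym last≡))) asc≡ , lastOr-∷ʳ 0 t v , bounded-∷ʳ bounded ≤-refl ,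
    nonDecreasing-∷ʳ nonDec bounded , (λ a b a<b b<v → skipLast v (below₂ a b a<b b<v)) ,
    (λ a a<v → skipLast v (below₁ a a<v)) , skipLast v top

  climbing-climb : ∀ {v t} → Inv (climbing v) t → Inv (climbing (suc v)) (t ∷ʳ suc v)
  climbing-climb {v} {t} (asc≡ , last≡ , bounded , nonDec , below₂ , below₁ , top) =
    trans (asc-∷ʳ-rise t (s≤s (≤-reflexive last≡))) (cong suc asc≡) , lastOr-∷ʳ 0 t (suc v) ,
    bounded-∷ʳ bounded′ ≤-refl , nonDecreasing-∷ʳ nonDec bounded′ , below₂′ , below₁′ ,
    keepLast (suc v) (subseq-[] (0 ∷ t))
    where
    bounded′ : Bounded (suc v) (0 ∷ t)
    bounded′ = bounded-weaken (n≤1+n v) bounded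
    below₂′ : ∀ a b → a < b → b < suc v → Sub₃ a b (suc v) ((0 ∷ t) ∷ʳ suc v)
    below₂′ a b a<b b<sv with m≤n⇒m<n∨m≡n (≤-pred b<sv)
    ... | inj₁ b<v = keepLast (suc v) (Sub₃⇒Sub₂ˡ (below₂ a b a<b b<v))
    ... | inj₂ refl = keepLast (suc v) (below₁ a a<b)
    below₁′ : ∀ a → a < suc v → Sub₂ a (suc v) ((0 ∷ t) ∷ʳ suc v)
    below₁′ a a<sv with m≤n⇒m<n∨m≡n (≤-pred a<sv)
    ... | inj₁ a<v = keepLast (suc v) (Sub₂⇒Sub₁ˡ (below₁ a a<v))
    ... | inj₂ refl = keepLast (suc v) top

  climbing-drop : ∀ {w t} → Inv (climbing (suc w)) t → Inv (dropped w) (t ∷ʳ w)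
  climbing-drop {w} {t} (_ , _ , bounded , nonDec , below₂ , below₁ , _) =
    lastOr-∷ʳ 0 t w , bounded-∷ʳ bounded (n≤1+n w) , after , before ,
    keepLast w (below₁ w (n<1+n w)) , (λ a a<w → skipLast w (below₂ a w a<w (n<1+n w)))
    where
    after : ∀ a → Sub₂ w a ((0 ∷ t) ∷ʳ w) → w ≤ a
    after a occ with Sub₂-∷ʳ⁻ (0 ∷ t) w occ
    ... | inj₁ occ′ = nonDec w a occ′
    ... | inj₂ (_ , refl) = ≤-refl
    before : ∀ x y → Sub₂ x y ((0 ∷ t) ∷ʳ w) → y < w → x ≤ y
    before x y occ y<w with Sub₂-∷ʳ⁻ (0 ∷ t) w occ
    ... | inj₁ occ′ = nonDec x y occ′
    ... | inj₂ (_ , refl) = ⊥-elim (<-irrefl refl y<w)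

  dropped-repeat : ∀ {w t} → Inv (dropped w) t → Good P t → Good P (t ∷ʳ w) × Inv (dropped w) (t ∷ʳ w)
  dropped-repeat {w} {t} (last≡ , bounded , after , before , peak , below) good =
    extend good (good⇒last≤ good last≡) no0101 no0102 (bounded⇒¬0120 bounded) ,
    lastOr-∷ʳ 0 t w , bounded-∷ʳ bounded (n≤1+n w) , after′ , before′ , skipLast w peak ,
    (λ a a<w → skipLast w (below a a<w))
    where
    no0101 : NoEnding Is0101 (0 ∷ t) w
    no0101 occ (a<b , refl , refl) = <⇒≱ a<b (after _ (Sub₃⇒Sub₂ʳ occ))
    no0102 : NoEnding Is0102 (0 ∷ t) w
    no0102 occ (a<b , refl , b<w) = <⇒≱ a<b (before _ _ (Sub₃⇒Sub₂ʳ occ) (<-trans a<b b<w))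
    after′ : ∀ a → Sub₂ w a ((0 ∷ t) ∷ʳ w) → w ≤ a
    after′ a occ with Sub₂-∷ʳ⁻ (0 ∷ t) w occ
    ... | inj₁ occ′ = after a occ′
    ... | inj₂ (_ , refl) = ≤-refl
    before′ : ∀ x y → Sub₂ x y ((0 ∷ t) ∷ʳ w) → y < w → x ≤ y
    before′ x y occ y<w with Sub₂-∷ʳ⁻ (0 ∷ t) w occ
    ... | inj₁ occ′ = before x y occ′ y<w
    ... | inj₂ (_ , refl) = ⊥-elim (<-irrefl refl y<w)

  grow : ∀ σ t d → Inv σ t → Good P t → d ∈ allowed σ → Good P (t ∷ʳ d) × Inv (next σ d) (t ∷ʳ d)
  grow (climbing zero) t .1 inv@(_ , _ , bounded , _) good (here refl) =
    climbing-good inv good ≤-refl (bounded-weaken z≤n bounded) , climbing-climb inv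
  grow (climbing zero) t .0 inv@(_ , _ , bounded , _) good (there (here refl)) =
    climbing-good inv good z≤n (bounded-weaken z≤n bounded) , climbing-stay inv
  grow (climbing (suc w)) t .(suc w) inv@(_ , _ , bounded , _) good (here refl) rewrite next-stay w =
    climbing-good inv good (n≤1+n _) (bounded-weaken (n≤1+n _) bounded) , climbing-stay inv
  grow (climbing (suc w)) t .(suc (suc w)) inv@(_ , _ , bounded , _) good (there (here refl)) rewrite next-climb w =
    climbing-good inv good ≤-refl (bounded-weaken (m≤n+m _ 2) bounded) , climbing-climb inv
  grow (climbing (suc w)) t .w inv@(_ , _ , bounded , _) good (there (there (here refl))) rewrite next-drop w =
    climbing-good inv good (m≤n+m w 2) bounded , climbing-drop inv
  grow (dropped w) t .w inv good (here refl) = dropped-repeat inv good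

  complete : ∀ σ t d → Inv σ t → Good P t → Good P (t ∷ʳ d) → d ∈ allowed σ
  complete (climbing zero) t d (asc≡ , _) _ good′ with ≤suc-≡ asc≡ (good-∷ʳ⇒bound good′)
  ... | z≤n = there (here refl)
  ... | s≤s z≤n = here refl
  complete (climbing (suc w)) t d (asc≡ , _ , _ , _ , below₂ , _) _ good′@(_ , _ ∷ _ ∷ av₃ ∷ []) with <-cmp d w
  ... | tri< d<w _ _ = ⊥-elim (av₃ (contains-∷ʳ pat0120 (below₂ d w d<w (n<1+n w)) (d<w , n<1+n w , refl)))
  ... | tri≈ _ refl _ = there (there (here refl))
  ... | tri> _ _ w<d with m≤n⇒m<n∨m≡n (≤suc-≡ asc≡ (good-∷ʳ⇒bound good′))
  ...   | inj₂ refl = there (here refl)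
  ...   | inj₁ d<2+w with ≤-antisym (≤-pred d<2+w) w<d
  ...     | refl = here refl
  complete (dropped w) t d (_ , _ , _ , _ , peak , below) _ (_ , av₁ ∷ av₂ ∷ av₃ ∷ []) with <-cmp d w
  ... | tri< d<w _ _ = ⊥-elim (av₃ (contains-∷ʳ pat0120 (below d d<w) (d<w , n<1+n w , refl)))
  ... | tri≈ _ refl _ = here refl
  ... | tri> _ _ w<d with m≤n⇒m<n∨m≡n w<d
  ...   | inj₂ refl = ⊥-elim (av₁ (contains-∷ʳ pat0101 peak (n<1+n w , refl , refl)))
  ...   | inj₁ sw<d = ⊥-elim (av₂ (contains-∷ʳ pat0102 peak (n<1+n w , refl , sw<d)))

  tree : GeneratingTree P
  tree = record
    { State = State ; root = climbing 0 ; allowed = allowed ; next = next ; Inv = Inv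
    ; allowed-unique = allowed-unique ; root-inv = root-inv
    ; root-good = tt , singleton-avoids ∷ singleton-avoids ∷ singleton-avoids ∷ []
    ; grow = grow ; complete = complete
    }

  open Enumeration tree

  size-dropped : ∀ w L → size (dropped w) L ≡ 1
  size-dropped w zero = refl
  size-dropped w (suc L) = trans (size-suc (dropped w) L) (trans (+-identityʳ _) (size-dropped w L))

  size-climbing : ∀ w L → size (climbing (suc w)) L + 1 ≡ 2 ^ suc L
  size-climbing w zero = refl
  size-climbing w (suc L) = 2^n∸1-step L size-climbing-suc (size-climbing w L) (size-climbing (suc w) L)
    where
    size-climbing-suc : size (climbing (suc w)) (suc L) ≡ size (climbing (suc w)) L + (size (climbing (suc (suc w))) L + 1)
    size-climbing-suc rewrite size-suc (climbing (suc w)) L | next-stay w | next-climb w | next-drop w | size-dropped w L = refl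

  count : ∀ n → 1 ≤ n → HasCount n P (2 ^ n ∸ n)
  count = hasCount-2^n∸n (size-root+n≡2^n (climbing 1) size-root-suc (size-climbing 0))
    where
    size-root-suc : ∀ L → size (climbing 0) (suc L) ≡ size (climbing 1) L + size (climbing 0) L
    size-root-suc L = trans (size-suc (climbing 0) L) (cong (size (climbing 1) L +_) (+-identityʳ _))

module Avoid-0101-0102-0121 where

  P : List (List ℕ)
  P = p0101 ∷ p0102 ∷ p0121 ∷ []

  -- zeros: only 0's so far.  climbing k: weakly increasing through 0, 1, …, k + 1, ending in k + 1.
  -- zeroTail: a climbing sequence followed by 0's.
  data State : Set where
    zeros zeroTail : State
    climbing : ℕ → State

  allowed : State → List ℕ
  allowed zeros = 1 ∷ 0 ∷ []
  allowed (climbing k) = suc k ∷ suc (suc k) ∷ 0 ∷ []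
  allowed zeroTail = 0 ∷ []

  next : State → ℕ → State
  next zeros zero = zeros
  next zeros (suc _) = climbing 0
  next (climbing k) zero = zeroTail
  next (climbing k) (suc d) = climbing d
  next zeroTail _ = zeroTail

  allowed-unique : ∀ σ → Unique (allowed σ)
  allowed-unique zeros = ((λ ()) ∷ []) ∷ [] ∷ []
  allowed-unique (climbing k) = ((λ e → 1+n≢n (sym e)) ∷ (λ ()) ∷ []) ∷ ((λ ()) ∷ []) ∷ [] ∷ []
  allowed-unique zeroTail = [] ∷ []

  Inv : State → List ℕ → Set
  Inv zeros t = asc (0 ∷ t) ≡ 0 × lastOr 0 t ≡ 0 × Bounded 0 (0 ∷ t)
  Inv (climbing k) t =
    asc (0 ∷ t) ≡ suc k × lastOr 0 t ≡ suc k × Bounded (suc k) (0 ∷ t) × NonDecreasing (0 ∷ t) ×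
    (∀ d → 1 ≤ d → d < suc k → Sub₃ 0 d (suc k) (0 ∷ t)) × Sub₂ 0 (suc k) (0 ∷ t) × Sub₂ 0 1 (0 ∷ t)
  Inv zeroTail t = Sub₃ 0 1 0 (0 ∷ t)

  extend : ∀ {t d} → Good P t → d ≤ suc (asc (0 ∷ t)) →
           NoEnding Is0101 (0 ∷ t) d → NoEnding Is0102 (0 ∷ t) d → NoEnding Is0121 (0 ∷ t) d → Good P (t ∷ʳ d)
  extend = good₃-∷ʳ pat0101 pat0102 pat0121

  extend-0 : ∀ {t} → Good P t → Good P (t ∷ʳ 0)
  extend-0 good = extend good z≤n 0⇒¬0101 0⇒¬0102 0⇒¬0121

  climbing-good : ∀ {k t d} → Inv (climbing k) t → Good P t → d ≤ suc (suc k) → suc k ≤ d → Good P (t ∷ʳ d)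
  climbing-good (asc≡ , _ , bounded , nonDec , _) good d≤ k<d =
    extend good (≤suc-≡ (sym asc≡) d≤) (nonDecreasing⇒¬0101 nonDec) (nonDecreasing⇒¬0102 nonDec)
      (bounded⇒¬0121 (bounded-weaken k<d bounded))

  zeros-stay : ∀ {t} → Inv zeros t → Inv zeros (t ∷ʳ 0)
  zeros-stay {t} (asc≡ , _ , bounded) = trans (asc-∷ʳ-flat t z≤n) asc≡ , lastOr-∷ʳ 0 t 0 , bounded-∷ʳ bounded z≤n

  zeros-climb : ∀ {t} → Inv zeros t → Inv (climbing 0) (t ∷ʳ 1)
  zeros-climb {t} (asc≡ , last≡ , bounded) =
    trans (asc-∷ʳ-rise t (s≤s (≤-reflexive last≡))) (cong suc asc≡) , lastOr-∷ʳ 0 t 1 ,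
    bounded-∷ʳ bounded′ ≤-refl , nonDecreasing-∷ʳ (bounded⇒nonDecreasing bounded) bounded′ ,
    (λ d 1≤d d<1 → ⊥-elim (<⇒≱ d<1 1≤d)) , keepLast 1 (Sub₁-head 0 t) , keepLast 1 (Sub₁-head 0 t)
    where
    bounded′ : Bounded 1 (0 ∷ t)
    bounded′ = bounded-weaken z≤n bounded

  climbing-stay : ∀ {k t} → Inv (climbing k) t → Inv (climbing k) (t ∷ʳ suc k)
  climbing-stay {k} {t} (asc≡ , last≡ , bounded , nonDec , below , top , one) =
    trans (asc-∷ʳ-flat t (≤-reflexive (sym last≡))) asc≡ , lastOr-∷ʳ 0 t (suc k) , bounded-∷ʳ bounded ≤-refl ,
    nonDecreasing-∷ʳ nonDec bounded , (λ d 1≤d d<sk → skipLast (suc k) (below d 1≤d d<sk)) ,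
    skipLast (suc k) top , skipLast (suc k) one

  climbing-climb : ∀ {k t} → Inv (climbing k) t → Inv (climbing (suc k)) (t ∷ʳ suc (suc k))
  climbing-climb {k} {t} (asc≡ , last≡ , bounded , nonDec , below , top , one) =
    trans (asc-∷ʳ-rise t (s≤s (≤-reflexive last≡))) (cong suc asc≡) , lastOr-∷ʳ 0 t (suc (suc k)) ,
    bounded-∷ʳ bounded′ ≤-refl , nonDecreasing-∷ʳ nonDec bounded′ , below′ ,
    keepLast (suc (suc k)) (Sub₁-head 0 t) , skipLast (suc (suc k)) one
    where
    bounded′ : Bounded (suc (suc k)) (0 ∷ t)
    bounded′ = bounded-weaken (n≤1+n (suc k)) bounded
    below′ : ∀ d → 1 ≤ d → d < suc (suc k) → Sub₃ 0 d (suc (suc k)) ((0 ∷ t) ∷ʳ suc (suc k))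
    below′ d 1≤d d<ssk with m≤n⇒m<n∨m≡n (≤-pred d<ssk)
    ... | inj₁ d<sk = keepLast (suc (suc k)) (Sub₃⇒Sub₂ˡ (below d 1≤d d<sk))
    ... | inj₂ refl = keepLast (suc (suc k)) top

  grow : ∀ σ t d → Inv σ t → Good P t → d ∈ allowed σ → Good P (t ∷ʳ d) × Inv (next σ d) (t ∷ʳ d)
  grow zeros t .1 inv@(asc≡ , _ , bounded) good (here refl) =
    extend good (≤suc-≡ (sym asc≡) ≤-refl) (nonDecreasing⇒¬0101 nonDec) (nonDecreasing⇒¬0102 nonDec)
      (bounded⇒¬0121 (bounded-weaken z≤n bounded)) , zeros-climb inv
    where
    nonDec : NonDecreasing (0 ∷ t)
    nonDec = bounded⇒nonDecreasing bounded
  grow zeros t .0 inv good (there (here refl)) = extend-0 good , zeros-stay inv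
  grow (climbing k) t .(suc k) inv good (here refl) = climbing-good inv good (n≤1+n _) ≤-refl , climbing-stay inv
  grow (climbing k) t .(suc (suc k)) inv good (there (here refl)) = climbing-good inv good ≤-refl (n≤1+n _) , climbing-climb inv
  grow (climbing k) t .0 (_ , _ , _ , _ , _ , _ , one) good (there (there (here refl))) = extend-0 good , keepLast 0 one
  grow zeroTail t .0 dip good (here refl) = extend-0 good , skipLast 0 dip

  complete : ∀ σ t d → Inv σ t → Good P t → Good P (t ∷ʳ d) → d ∈ allowed σ
  complete zeros t d (asc≡ , _) _ good′ with ≤suc-≡ asc≡ (good-∷ʳ⇒bound good′)
  ... | z≤n = there (here refl)
  ... | s≤s z≤n = here refl
  complete (climbing k) t zero _ _ _ = there (there (here refl))
  complete (climbing k) t (suc d) (asc≡ , _ , _ , _ , below , _) _ good′@(_ , _ ∷ _ ∷ av₃ ∷ []) with <-cmp (suc d) (suc k)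
  ... | tri< d<k _ _ = ⊥-elim (av₃ (contains-∷ʳ pat0121 (below (suc d) (s≤s z≤n) d<k) (s≤s z≤n , d<k , refl)))
  ... | tri≈ _ refl _ = here refl
  ... | tri> _ _ k<d with ≤-antisym (≤suc-≡ asc≡ (good-∷ʳ⇒bound good′)) k<d
  ...   | refl = there (here refl)
  complete zeroTail t zero _ _ _ = here refl
  complete zeroTail t (suc zero) dip _ (_ , av₁ ∷ _ ∷ _ ∷ []) =
    ⊥-elim (av₁ (contains-∷ʳ pat0101 dip (s≤s z≤n , refl , refl)))
  complete zeroTail t (suc (suc d)) dip _ (_ , _ ∷ av₂ ∷ _ ∷ []) =
    ⊥-elim (av₂ (contains-∷ʳ pat0102 dip (s≤s z≤n , refl , s≤s (s≤s z≤n))))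

  tree : GeneratingTree P
  tree = record
    { State = State ; root = zeros ; allowed = allowed ; next = next ; Inv = Inv
    ; allowed-unique = allowed-unique ; root-inv = refl , refl , [0]-bounded
    ; root-good = tt , singleton-avoids ∷ singleton-avoids ∷ singleton-avoids ∷ []
    ; grow = grow ; complete = complete
    }

  open Enumeration tree

  size-zeroTail : ∀ L → size zeroTail L ≡ 1
  size-zeroTail zero = refl
  size-zeroTail (suc L) = trans (size-suc zeroTail L) (trans (+-identityʳ _) (size-zeroTail L))

  size-climbing : ∀ k L → size (climbing k) L + 1 ≡ 2 ^ suc L
  size-climbing k zero = refl
  size-climbing k (suc L) = 2^n∸1-step L size-climbing-suc (size-climbing k L) (size-climbing (suc k) L)
    where
    size-climbing-suc : size (climbing k) (suc L) ≡ size (climbing k) L + (size (climbing (suc k)) L + 1)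
    size-climbing-suc = trans (size-suc (climbing k) L)
      (cong (λ z → size (climbing k) L + (size (climbing (suc k)) L + (z + 0))) (size-zeroTail L))

  count : ∀ n → 1 ≤ n → HasCount n P (2 ^ n ∸ n)
  count = hasCount-2^n∸n (size-root+n≡2^n (climbing 0) size-root-suc (size-climbing 0))
    where
    size-root-suc : ∀ L → size zeros (suc L) ≡ size (climbing 0) L + size zeros L
    size-root-suc L = trans (size-suc zeros L) (cong (size (climbing 0) L +_) (+-identityʳ _))

module Avoid-0101-0112-0121 where

  P : List (List ℕ)
  P = p0101 ∷ p0112 ∷ p0121 ∷ []

  -- atZero m: maximum m and last letter 0.  atPeak k: the last letter is a new maximum k + 1.
  -- plateau k: that maximum has been repeated.  closed k: a plateau followed by 0's.
  data State : Set where
    atZero atPeak plateau closed : ℕ → State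

  allowed : State → List ℕ
  allowed (atZero m) = suc m ∷ 0 ∷ []
  allowed (atPeak k) = 0 ∷ suc k ∷ suc (suc k) ∷ []
  allowed (plateau k) = suc k ∷ 0 ∷ []
  allowed (closed k) = 0 ∷ []

  next : State → ℕ → State
  next (atZero m) zero = atZero m
  next (atZero m) (suc _) = atPeak m
  next (atPeak k) zero = atZero (suc k)
  next (atPeak k) (suc d) = if d <ᵇ suc k then plateau k else atPeak (suc k)
  next (plateau k) zero = closed k
  next (plateau k) (suc _) = plateau k
  next (closed k) _ = closed k

  next-repeat : ∀ k → next (atPeak k) (suc k) ≡ plateau k
  next-repeat k rewrite <ᵇ-true (n<1+n k) = refl

  next-peak : ∀ k → next (atPeak k) (suc (suc k)) ≡ atPeak (suc k)
  next-peak k rewrite <ᵇ-false (≤-refl {suc k}) = refl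

  allowed-unique : ∀ σ → Unique (allowed σ)
  allowed-unique (atZero m) = ((λ ()) ∷ []) ∷ [] ∷ []
  allowed-unique (atPeak k) = ((λ ()) ∷ (λ ()) ∷ []) ∷ ((λ e → 1+n≢n (sym e)) ∷ []) ∷ [] ∷ []
  allowed-unique (plateau k) = ((λ ()) ∷ []) ∷ [] ∷ []
  allowed-unique (closed k) = [] ∷ []

  No011 : List ℕ → Set
  No011 u = ∀ {a b} → Sub₃ a b b u → ¬ a < b

  no011-∷ʳ0 : ∀ {u} → No011 u → No011 (u ∷ʳ 0)
  no011-∷ʳ0 {u} no011 occ a<b with Sub₃-∷ʳ⁻ u 0 occ
  ... | inj₁ occ′ = no011 occ′ a<b
  ... | inj₂ (_ , refl) = n≮0 a<b

  no011-∷ʳ-fresh : ∀ {u d} → No011 u → ¬ Sub₁ d u → No011 (u ∷ʳ d)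
  no011-∷ʳ-fresh {u} {d} no011 d∉u occ a<b with Sub₃-∷ʳ⁻ u d occ
  ... | inj₁ occ′ = no011 occ′ a<b
  ... | inj₂ (occ′ , refl) = d∉u (Sub₂⇒Sub₁ʳ occ′)

  fresh⇒last : ∀ {u d y} → ¬ Sub₁ d u → ¬ Sub₂ d y (u ∷ʳ d)
  fresh⇒last {u} {d} d∉u occ with Sub₂-∷ʳ⁻ u d occ
  ... | inj₁ occ′ = d∉u (Sub₂⇒Sub₁ˡ occ′)
  ... | inj₂ (d∈u , _) = d∉u d∈u

  no011⇒¬0112 : ∀ {u d} → No011 u → NoEnding Is0112 u d
  no011⇒¬0112 no011 occ (a<b , refl , _) = no011 occ a<b

  Inv : State → List ℕ → Set
  Inv (atZero m) t =
    asc (0 ∷ t) ≡ m × lastOr 0 t ≡ 0 × Bounded m (0 ∷ t) × No011 (0 ∷ t) ×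
    (∀ d → 1 ≤ d → d ≤ m → Sub₃ 0 d 0 (0 ∷ t))
  Inv (atPeak k) t =
    asc (0 ∷ t) ≡ suc k × lastOr 0 t ≡ suc k × Bounded (suc k) (0 ∷ t) × No011 (0 ∷ t) ×
    (∀ y → ¬ Sub₂ (suc k) y (0 ∷ t)) × (∀ d → 1 ≤ d → d ≤ suc k → Sub₂ 0 d (0 ∷ t)) ×
    (∀ d → 1 ≤ d → d < suc k → Sub₃ 0 d (suc k) (0 ∷ t))
  Inv (plateau k) t =
    lastOr 0 t ≡ suc k × Bounded (suc k) (0 ∷ t) × (∀ y → Sub₂ (suc k) y (0 ∷ t) → y ≡ suc k) ×
    (∀ a b → Sub₃ a b b (0 ∷ t) → a < b → b ≡ suc k) ×
    (∀ d → 1 ≤ d → d < suc k → Sub₃ 0 d (suc k) (0 ∷ t)) ×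
    Sub₃ 0 (suc k) (suc k) (0 ∷ t) × (∀ d → 1 ≤ d → d ≤ suc k → Sub₂ 0 d (0 ∷ t))
  Inv (closed k) t = Sub₃ 0 (suc k) (suc k) (0 ∷ t) × (∀ d → 1 ≤ d → d ≤ suc k → Sub₃ 0 d 0 (0 ∷ t))

  root-inv : Inv (atZero 0) []
  root-inv = refl , refl , [0]-bounded , (λ { (skip _ ()) ; (keep _ ()) }) , (λ d 1≤d d≤0 → ⊥-elim (<⇒≱ 1≤d d≤0))

  extend : ∀ {t d} → Good P t → d ≤ suc (asc (0 ∷ t)) →
           NoEnding Is0101 (0 ∷ t) d → NoEnding Is0112 (0 ∷ t) d → NoEnding Is0121 (0 ∷ t) d → Good P (t ∷ʳ d)
  extend = good₃-∷ʳ pat0101 pat0112 pat0121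

  extend-0 : ∀ {t} → Good P t → Good P (t ∷ʳ 0)
  extend-0 good = extend good z≤n 0⇒¬0101 0⇒¬0112 0⇒¬0121

  extend-fresh : ∀ {t d} → Good P t → d ≤ suc (asc (0 ∷ t)) → No011 (0 ∷ t) → ¬ Sub₁ d (0 ∷ t) → Good P (t ∷ʳ d)
  extend-fresh good d≤ no011 d∉u = extend good d≤ (fresh⇒¬0101 d∉u) (no011⇒¬0112 no011) (fresh⇒¬0121 d∉u)

  atZero-peak : ∀ {m t} → Inv (atZero m) t → Good P t → Good P (t ∷ʳ suc m) × Inv (atPeak m) (t ∷ʳ suc m)
  atZero-peak {m} {t} (asc≡ , last≡ , bounded , no011 , zeroed) good =
    extend-fresh good (≤suc-≡ (sym asc≡) ≤-refl) no011 fresh ,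
    trans (asc-∷ʳ-rise t (subst (_< suc m) (sym last≡) (s≤s z≤n))) (cong suc asc≡) , lastOr-∷ʳ 0 t (suc m) ,
    bounded-∷ʳ (bounded-weaken (n≤1+n m) bounded) ≤-refl , no011-∷ʳ-fresh no011 fresh , (λ _ → fresh⇒last fresh) ,
    reached , (λ d 1≤d d<sm → keepLast (suc m) (Sub₃⇒Sub₂ˡ (zeroed d 1≤d (≤-pred d<sm))))
    where
    fresh : ¬ Sub₁ (suc m) (0 ∷ t)
    fresh = bounded⇒∉ bounded ≤-refl
    reached : ∀ d → 1 ≤ d → d ≤ suc m → Sub₂ 0 d ((0 ∷ t) ∷ʳ suc m)
    reached d 1≤d d≤ with m≤n⇒m<n∨m≡n d≤
    ... | inj₁ d<sm = skipLast (suc m) (Sub₃⇒Sub₂ˡ (zeroed d 1≤d (≤-pred d<sm)))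
    ... | inj₂ refl = keepLast (suc m) (Sub₁-head 0 t)

  atZero-stay : ∀ {m t} → Inv (atZero m) t → Inv (atZero m) (t ∷ʳ 0)
  atZero-stay {t = t} (asc≡ , _ , bounded , no011 , zeroed) =
    trans (asc-∷ʳ-flat t z≤n) asc≡ , lastOr-∷ʳ 0 t 0 , bounded-∷ʳ bounded z≤n , no011-∷ʳ0 no011 ,
    (λ d 1≤d d≤m → skipLast 0 (zeroed d 1≤d d≤m))

  atPeak-zero : ∀ {k t} → Inv (atPeak k) t → Inv (atZero (suc k)) (t ∷ʳ 0)
  atPeak-zero {t = t} (asc≡ , _ , bounded , no011 , _ , reached , _) =
    trans (asc-∷ʳ-flat t z≤n) asc≡ , lastOr-∷ʳ 0 t 0 , bounded-∷ʳ bounded z≤n , no011-∷ʳ0 no011 ,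
    (λ d 1≤d d≤sk → keepLast 0 (reached d 1≤d d≤sk))

  atPeak-repeat : ∀ {k t} → Inv (atPeak k) t → Good P t → Good P (t ∷ʳ suc k) × Inv (plateau k) (t ∷ʳ suc k)
  atPeak-repeat {k} {t} (asc≡ , _ , bounded , no011 , nothing-after , reached , below) good =
    extend good (≤suc-≡ (sym asc≡) (n≤1+n _)) no0101 (no011⇒¬0112 no011) (bounded⇒¬0121 bounded) ,
    lastOr-∷ʳ 0 t (suc k) , bounded-∷ʳ bounded ≤-refl , after , rises ,
    (λ d 1≤d d<sk → skipLast (suc k) (below d 1≤d d<sk)) , keepLast (suc k) (reached (suc k) (s≤s z≤n) ≤-refl) ,
    (λ d 1≤d d≤sk → skipLast (suc k) (reached d 1≤d d≤sk))
    where
    no0101 : NoEnding Is0101 (0 ∷ t) (suc k)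
    no0101 occ (_ , refl , refl) = nothing-after _ (Sub₃⇒Sub₂ʳ occ)
    after : ∀ y → Sub₂ (suc k) y ((0 ∷ t) ∷ʳ suc k) → y ≡ suc k
    after y occ with Sub₂-∷ʳ⁻ (0 ∷ t) (suc k) occ
    ... | inj₁ occ′ = ⊥-elim (nothing-after y occ′)
    ... | inj₂ (_ , y≡sk) = y≡sk
    rises : ∀ a b → Sub₃ a b b ((0 ∷ t) ∷ʳ suc k) → a < b → b ≡ suc k
    rises a b occ a<b with Sub₃-∷ʳ⁻ (0 ∷ t) (suc k) occ
    ... | inj₁ occ′ = ⊥-elim (no011 occ′ a<b)
    ... | inj₂ (_ , b≡sk) = b≡sk

  atPeak-peak : ∀ {k t} → Inv (atPeak k) t → Good P t → Good P (t ∷ʳ suc (suc k)) × Inv (atPeak (suc k)) (t ∷ʳ suc (suc k))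
  atPeak-peak {k} {t} (asc≡ , last≡ , bounded , no011 , _ , reached , _) good =
    extend-fresh good (≤suc-≡ (sym asc≡) ≤-refl) no011 fresh ,
    trans (asc-∷ʳ-rise t (s≤s (≤-reflexive last≡))) (cong suc asc≡) , lastOr-∷ʳ 0 t (suc (suc k)) ,
    bounded-∷ʳ (bounded-weaken (n≤1+n (suc k)) bounded) ≤-refl , no011-∷ʳ-fresh no011 fresh , (λ _ → fresh⇒last fresh) ,
    reached′ , (λ d 1≤d d<ssk → keepLast (suc (suc k)) (reached d 1≤d (≤-pred d<ssk)))
    where
    fresh : ¬ Sub₁ (suc (suc k)) (0 ∷ t)
    fresh = bounded⇒∉ bounded ≤-refl
    reached′ : ∀ d → 1 ≤ d → d ≤ suc (suc k) → Sub₂ 0 d ((0 ∷ t) ∷ʳ suc (suc k))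
    reached′ d 1≤d d≤ with m≤n⇒m<n∨m≡n d≤
    ... | inj₁ d<ssk = skipLast (suc (suc k)) (reached d 1≤d (≤-pred d<ssk))
    ... | inj₂ refl = keepLast (suc (suc k)) (Sub₁-head 0 t)

  plateau-repeat : ∀ {k t} → Inv (plateau k) t → Good P t → Good P (t ∷ʳ suc k) × Inv (plateau k) (t ∷ʳ suc k)
  plateau-repeat {k} {t} (last≡ , bounded , after , rises , below , top , reached) good =
    extend good (good⇒last≤ good last≡) no0101 no0112 (bounded⇒¬0121 bounded) ,
    lastOr-∷ʳ 0 t (suc k) , bounded-∷ʳ bounded ≤-refl , after′ , rises′ ,
    (λ d 1≤d d<sk → skipLast (suc k) (below d 1≤d d<sk)) , skipLast (suc k) top ,
    (λ d 1≤d d≤sk → skipLast (suc k) (reached d 1≤d d≤sk))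
    where
    no0101 : NoEnding Is0101 (0 ∷ t) (suc k)
    no0101 occ (a<b , refl , refl) = <-irrefl (after _ (Sub₃⇒Sub₂ʳ occ)) a<b
    no0112 : NoEnding Is0112 (0 ∷ t) (suc k)
    no0112 occ (a<b , refl , b<sk) = <-irrefl (rises _ _ occ a<b) b<sk
    after′ : ∀ y → Sub₂ (suc k) y ((0 ∷ t) ∷ʳ suc k) → y ≡ suc k
    after′ y occ with Sub₂-∷ʳ⁻ (0 ∷ t) (suc k) occ
    ... | inj₁ occ′ = after y occ′
    ... | inj₂ (_ , y≡sk) = y≡sk
    rises′ : ∀ a b → Sub₃ a b b ((0 ∷ t) ∷ʳ suc k) → a < b → b ≡ suc k
    rises′ a b occ a<b with Sub₃-∷ʳ⁻ (0 ∷ t) (suc k) occ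
    ... | inj₁ occ′ = rises a b occ′ a<b
    ... | inj₂ (_ , b≡sk) = b≡sk

  grow : ∀ σ t d → Inv σ t → Good P t → d ∈ allowed σ → Good P (t ∷ʳ d) × Inv (next σ d) (t ∷ʳ d)
  grow (atZero m) t .(suc m) inv good (here refl) = atZero-peak inv good
  grow (atZero m) t .0 inv good (there (here refl)) = extend-0 good , atZero-stay inv
  grow (atPeak k) t .0 inv good (here refl) = extend-0 good , atPeak-zero inv
  grow (atPeak k) t .(suc k) inv good (there (here refl)) rewrite next-repeat k = atPeak-repeat inv good
  grow (atPeak k) t .(suc (suc k)) inv good (there (there (here refl))) rewrite next-peak k = atPeak-peak inv good
  grow (plateau k) t .(suc k) inv good (here refl) = plateau-repeat inv good
  grow (plateau k) t .0 (_ , _ , _ , _ , _ , top , reached) good (there (here refl)) =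
    extend-0 good , skipLast 0 top , (λ d 1≤d d≤sk → keepLast 0 (reached d 1≤d d≤sk))
  grow (closed k) t .0 (top , zeroed) good (here refl) =
    extend-0 good , skipLast 0 top , (λ d 1≤d d≤sk → skipLast 0 (zeroed d 1≤d d≤sk))

  complete : ∀ σ t d → Inv σ t → Good P t → Good P (t ∷ʳ d) → d ∈ allowed σ
  complete (atZero m) t zero _ _ _ = there (here refl)
  complete (atZero m) t (suc d) (asc≡ , _ , _ , _ , zeroed) _ good′@(_ , av₁ ∷ _ ∷ _ ∷ [])
    with m≤n⇒m<n∨m≡n (≤suc-≡ asc≡ (good-∷ʳ⇒bound good′))
  ... | inj₂ refl = here refl
  ... | inj₁ (s≤s d<m) = ⊥-elim (av₁ (contains-∷ʳ pat0101 (zeroed (suc d) (s≤s z≤n) d<m) (s≤s z≤n , refl , refl)))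
  complete (atPeak k) t zero _ _ _ = here refl
  complete (atPeak k) t (suc d) (asc≡ , _ , _ , _ , _ , _ , below) _ good′@(_ , _ ∷ _ ∷ av₃ ∷ []) with <-cmp (suc d) (suc k)
  ... | tri< d<k _ _ = ⊥-elim (av₃ (contains-∷ʳ pat0121 (below (suc d) (s≤s z≤n) d<k) (s≤s z≤n , d<k , refl)))
  ... | tri≈ _ refl _ = there (here refl)
  ... | tri> _ _ k<d with ≤-antisym (≤suc-≡ asc≡ (good-∷ʳ⇒bound good′)) k<d
  ...   | refl = there (there (here refl))
  complete (plateau k) t zero _ _ _ = there (here refl)
  complete (plateau k) t (suc d) (_ , _ , _ , _ , below , top , _) _ (_ , _ ∷ av₂ ∷ av₃ ∷ []) with <-cmp (suc d) (suc k)
  ... | tri< d<k _ _ = ⊥-elim (av₃ (contains-∷ʳ pat0121 (below (suc d) (s≤s z≤n) d<k) (s≤s z≤n , d<k , refl)))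
  ... | tri≈ _ refl _ = here refl
  ... | tri> _ _ k<d = ⊥-elim (av₂ (contains-∷ʳ pat0112 top (s≤s z≤n , refl , k<d)))
  complete (closed k) t zero _ _ _ = here refl
  complete (closed k) t (suc d) (top , zeroed) _ (_ , av₁ ∷ av₂ ∷ _ ∷ []) with suc d ≤? suc k
  ... | yes d≤k = ⊥-elim (av₁ (contains-∷ʳ pat0101 (zeroed (suc d) (s≤s z≤n) d≤k) (s≤s z≤n , refl , refl)))
  ... | no d≰k = ⊥-elim (av₂ (contains-∷ʳ pat0112 top (s≤s z≤n , refl , ≰⇒> d≰k)))

  tree : GeneratingTree P
  tree = record
    { State = State ; root = atZero 0 ; allowed = allowed ; next = next ; Inv = Inv
    ; allowed-unique = allowed-unique ; root-inv = root-inv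
    ; root-good = tt , singleton-avoids ∷ singleton-avoids ∷ singleton-avoids ∷ []
    ; grow = grow ; complete = complete
    }

  open Enumeration tree

  size-closed : ∀ k L → size (closed k) L ≡ 1
  size-closed k zero = refl
  size-closed k (suc L) = trans (size-suc (closed k) L) (trans (+-identityʳ _) (size-closed k L))

  size-plateau : ∀ k L → size (plateau k) L ≡ suc L
  size-plateau k zero = refl
  size-plateau k (suc L) = begin
    size (plateau k) (suc L)                   ≡⟨ size-suc (plateau k) L ⟩
    size (plateau k) L + (size (closed k) L + 0) ≡⟨ cong₂ (λ x y → x + (y + 0)) (size-plateau k L) (size-closed k L) ⟩
    suc L + 1                                  ≡⟨ +-comm (suc L) 1 ⟩
    suc (suc L)                                ∎
    where open ≡-Reasoning

  mutual
    size-atZero : ∀ m L → size (atZero m) L + suc L ≡ 2 ^ suc L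
    size-atZero m zero = refl
    size-atZero m (suc L) = 2^n∸n-step L size-atZero-suc (size-atPeak m L) (size-atZero m L)
      where
      size-atZero-suc : size (atZero m) (suc L) ≡ size (atPeak m) L + size (atZero m) L
      size-atZero-suc = trans (size-suc (atZero m) L) (cong (size (atPeak m) L +_) (+-identityʳ _))

    size-atPeak : ∀ k L → size (atPeak k) L + 1 ≡ 2 ^ suc L
    size-atPeak k zero = refl
    size-atPeak k (suc L) = begin
      size (atPeak k) (suc L) + 1
        ≡⟨ cong (_+ 1) size-atPeak-suc ⟩
      size (atZero (suc k)) L + (suc L + (size (atPeak (suc k)) L + 0)) + 1
        ≡⟨ regroup (size (atZero (suc k)) L) (suc L) (size (atPeak (suc k)) L) ⟩
      (size (atZero (suc k)) L + suc L) + ((size (atPeak (suc k)) L + 1) + 0)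
        ≡⟨ cong₂ (λ x y → x + (y + 0)) (size-atZero (suc k) L) (size-atPeak (suc k) L) ⟩
      2 ^ suc L + (2 ^ suc L + 0)
        ∎
      where
      open ≡-Reasoning
      size-atPeak-suc : size (atPeak k) (suc L) ≡ size (atZero (suc k)) L + (suc L + (size (atPeak (suc k)) L + 0))
      size-atPeak-suc rewrite size-suc (atPeak k) L | next-repeat k | next-peak k | size-plateau k L = refl
      regroup : ∀ z l y → z + (l + (y + 0)) + 1 ≡ (z + l) + ((y + 1) + 0)
      regroup = solve-∀

  count : ∀ n → 1 ≤ n → HasCount n P (2 ^ n ∸ n)
  count = hasCount-2^n∸n (size-atZero 0)

module Avoid-0101-0120-0121 where

  P : List (List ℕ)
  P = p0101 ∷ p0120 ∷ p0121 ∷ []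

  -- zeros: only 0's.  ones: 0⋯0 1⋯1.  dipped: 0⋯0 1⋯1 0⋯0.  climbing v (v ≥ 2): a ones or dipped
  -- sequence followed by a weakly increasing run from 2 up to v, ending in v.
  data State : Set where
    zeros ones dipped : State
    climbing : ℕ → State

  allowed : State → List ℕ
  allowed zeros = 1 ∷ 0 ∷ []
  allowed ones = 1 ∷ 2 ∷ 0 ∷ []
  allowed dipped = 2 ∷ 0 ∷ []
  allowed (climbing v) = v ∷ suc v ∷ []

  next : State → ℕ → State
  next zeros zero = zeros
  next zeros (suc _) = ones
  next ones zero = dipped
  next ones (suc zero) = ones
  next ones (suc (suc _)) = climbing 2
  next dipped zero = dipped
  next dipped (suc _) = climbing 2
  next (climbing v) d = climbing d

  allowed-unique : ∀ σ → Unique (allowed σ)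
  allowed-unique zeros = ((λ ()) ∷ []) ∷ [] ∷ []
  allowed-unique ones = ((λ ()) ∷ (λ ()) ∷ []) ∷ ((λ ()) ∷ []) ∷ [] ∷ []
  allowed-unique dipped = ((λ ()) ∷ []) ∷ [] ∷ []
  allowed-unique (climbing v) = ((λ e → 1+n≢n (sym e)) ∷ []) ∷ [] ∷ []

  NonDecreasingFrom2 : List ℕ → Set
  NonDecreasingFrom2 u = ∀ x y → Sub₂ x y u → 2 ≤ x → x ≤ y

  Inv : State → List ℕ → Set
  Inv zeros t = asc (0 ∷ t) ≡ 0 × lastOr 0 t ≡ 0 × Bounded 0 (0 ∷ t)
  Inv ones t = asc (0 ∷ t) ≡ 1 × lastOr 0 t ≡ 1 × Bounded 1 (0 ∷ t) × NonDecreasing (0 ∷ t) × Sub₂ 0 1 (0 ∷ t)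
  Inv dipped t = asc (0 ∷ t) ≡ 1 × lastOr 0 t ≡ 0 × Bounded 1 (0 ∷ t) × Sub₃ 0 1 0 (0 ∷ t)
  Inv (climbing v) t =
    2 ≤ v × asc (0 ∷ t) ≡ v × lastOr 0 t ≡ v × Bounded v (0 ∷ t) × NonDecreasingFrom2 (0 ∷ t) ×
    (∀ d → 1 ≤ d → d < v → Sub₃ 0 d v (0 ∷ t)) × Sub₂ 0 v (0 ∷ t)

  extend : ∀ {t d} → Good P t → d ≤ suc (asc (0 ∷ t)) →
           NoEnding Is0101 (0 ∷ t) d → NoEnding Is0120 (0 ∷ t) d → NoEnding Is0121 (0 ∷ t) d → Good P (t ∷ʳ d)
  extend = good₃-∷ʳ pat0101 pat0120 pat0121

  extend-0 : ∀ {t} → Bounded 1 (0 ∷ t) → Good P t → Good P (t ∷ʳ 0)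
  extend-0 bounded good = extend good z≤n 0⇒¬0101 (bounded⇒¬0120 bounded) 0⇒¬0121

  extend-fresh : ∀ {t d} → Good P t → d ≤ suc (asc (0 ∷ t)) → ¬ Sub₁ d (0 ∷ t) → Good P (t ∷ʳ d)
  extend-fresh good d≤ d∉u = extend good d≤ (fresh⇒¬0101 d∉u) (fresh⇒¬0120 d∉u) (fresh⇒¬0121 d∉u)

  nonDecreasingFrom2-∷ʳ : ∀ {u d} → NonDecreasingFrom2 u → Bounded d u → NonDecreasingFrom2 (u ∷ʳ d)
  nonDecreasingFrom2-∷ʳ {u} {d} nonDec bounded x y occ 2≤x with Sub₂-∷ʳ⁻ u d occ
  ... | inj₁ occ′ = nonDec x y occ′ 2≤x
  ... | inj₂ (occ′ , refl) = bounded x occ′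

  binary⇒nonDecreasingFrom2 : ∀ {u} → Bounded 1 u → NonDecreasingFrom2 u
  binary⇒nonDecreasingFrom2 bounded x y occ 2≤x = ⊥-elim (<⇒≱ 2≤x (bounded x (Sub₂⇒Sub₁ˡ occ)))

  binary⇒climbing : ∀ {t} → asc (0 ∷ t) ≡ 1 → lastOr 0 t ≤ 1 → Bounded 1 (0 ∷ t) → Sub₂ 0 1 (0 ∷ t) →
                    Inv (climbing 2) (t ∷ʳ 2)
  binary⇒climbing {t} asc≡ last≤1 bounded one =
    ≤-refl , trans (asc-∷ʳ-rise t (s≤s last≤1)) (cong suc asc≡) , lastOr-∷ʳ 0 t 2 ,
    bounded-∷ʳ (bounded-weaken (n≤1+n 1) bounded) ≤-refl ,
    nonDecreasingFrom2-∷ʳ (binary⇒nonDecreasingFrom2 bounded) (bounded-weaken (n≤1+n 1) bounded) ,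
    (λ { .1 (s≤s z≤n) (s≤s (s≤s z≤n)) → keepLast 2 one }) , keepLast 2 (Sub₁-head 0 t)

  climbing-stay : ∀ {v t} → Inv (climbing v) t → Inv (climbing v) (t ∷ʳ v)
  climbing-stay {v} {t} (2≤v , asc≡ , last≡ , bounded , nonDec , below , top) =
    2≤v , trans (asc-∷ʳ-flat t (≤-reflexive (sym last≡))) asc≡ , lastOr-∷ʳ 0 t v , bounded-∷ʳ bounded ≤-refl ,
    nonDecreasingFrom2-∷ʳ nonDec bounded , (λ d 1≤d d<v → skipLast v (below d 1≤d d<v)) , skipLast v top

  climbing-climb : ∀ {v t} → Inv (climbing v) t → Inv (climbing (suc v)) (t ∷ʳ suc v)
  climbing-climb {v} {t} (2≤v , asc≡ , last≡ , bounded , nonDec , below , top) =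
    m≤n⇒m≤1+n 2≤v , trans (asc-∷ʳ-rise t (s≤s (≤-reflexive last≡))) (cong suc asc≡) , lastOr-∷ʳ 0 t (suc v) ,
    bounded-∷ʳ bounded′ ≤-refl , nonDecreasingFrom2-∷ʳ nonDec bounded′ , below′ , keepLast (suc v) (Sub₁-head 0 t)
    where
    bounded′ : Bounded (suc v) (0 ∷ t)
    bounded′ = bounded-weaken (n≤1+n v) bounded
    below′ : ∀ d → 1 ≤ d → d < suc v → Sub₃ 0 d (suc v) ((0 ∷ t) ∷ʳ suc v)
    below′ d 1≤d d<sv with m≤n⇒m<n∨m≡n (≤-pred d<sv)
    ... | inj₁ d<v = keepLast (suc v) (Sub₃⇒Sub₂ˡ (below d 1≤d d<v))
    ... | inj₂ refl = keepLast (suc v) top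

  grow : ∀ σ t d → Inv σ t → Good P t → d ∈ allowed σ → Good P (t ∷ʳ d) × Inv (next σ d) (t ∷ʳ d)
  grow zeros t .1 (asc≡ , last≡ , bounded) good (here refl) =
    extend good (≤suc-≡ (sym asc≡) ≤-refl) (fresh⇒¬0101 (bounded⇒∉ bounded ≤-refl))
      (bounded⇒¬0120 (bounded-weaken z≤n bounded)) (binary⇒¬0121 bounded′) ,
    trans (asc-∷ʳ-rise t (s≤s (≤-reflexive last≡))) (cong suc asc≡) , lastOr-∷ʳ 0 t 1 , bounded-∷ʳ bounded′ ≤-refl ,
    nonDecreasing-∷ʳ (bounded⇒nonDecreasing bounded) bounded′ , keepLast 1 (Sub₁-head 0 t)
    where
    bounded′ : Bounded 1 (0 ∷ t)
    bounded′ = bounded-weaken z≤n bounded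
  grow zeros t .0 (asc≡ , _ , bounded) good (there (here refl)) =
    extend-0 (bounded-weaken z≤n bounded) good ,
    trans (asc-∷ʳ-flat t z≤n) asc≡ , lastOr-∷ʳ 0 t 0 , bounded-∷ʳ bounded z≤n
  grow ones t .1 (asc≡ , last≡ , bounded , nonDec , one) good (here refl) =
    extend good (≤suc-≡ (sym asc≡) (n≤1+n 1)) (nonDecreasing⇒¬0101 nonDec)
      (bounded⇒¬0120 (bounded-weaken (n≤1+n 1) bounded)) (binary⇒¬0121 bounded) ,
    trans (asc-∷ʳ-flat t (≤-reflexive (sym last≡))) asc≡ , lastOr-∷ʳ 0 t 1 , bounded-∷ʳ bounded ≤-refl ,
    nonDecreasing-∷ʳ nonDec bounded , skipLast 1 one
  grow ones t .2 (asc≡ , last≡ , bounded , _ , one) good (there (here refl)) =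
    extend-fresh good (≤suc-≡ (sym asc≡) ≤-refl) (bounded⇒∉ bounded ≤-refl) ,
    binary⇒climbing asc≡ (≤-reflexive last≡) bounded one
  grow ones t .0 (asc≡ , _ , bounded , _ , one) good (there (there (here refl))) =
    extend-0 bounded good , trans (asc-∷ʳ-flat t z≤n) asc≡ , lastOr-∷ʳ 0 t 0 , bounded-∷ʳ bounded z≤n , keepLast 0 one
  grow dipped t .2 (asc≡ , last≡ , bounded , dip) good (here refl) =
    extend-fresh good (≤suc-≡ (sym asc≡) ≤-refl) (bounded⇒∉ bounded ≤-refl) ,
    binary⇒climbing asc≡ (≤-trans (≤-reflexive last≡) z≤n) bounded (Sub₃⇒Sub₂ˡ dip)
  grow dipped t .0 (asc≡ , _ , bounded , dip) good (there (here refl)) =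
    extend-0 bounded good , trans (asc-∷ʳ-flat t z≤n) asc≡ , lastOr-∷ʳ 0 t 0 , bounded-∷ʳ bounded z≤n , skipLast 0 dip
  grow (climbing v) t .v inv@(2≤v , asc≡ , _ , bounded , nonDec , _) good (here refl) =
    extend good (≤suc-≡ (sym asc≡) (n≤1+n v)) no0101 (bounded⇒¬0120 (bounded-weaken (n≤1+n v) bounded))
      (bounded⇒¬0121 bounded) ,
    climbing-stay inv
    where
    no0101 : NoEnding Is0101 (0 ∷ t) v
    no0101 occ (a<b , refl , refl) = <⇒≱ a<b (nonDec _ _ (Sub₃⇒Sub₂ʳ occ) 2≤v)
  grow (climbing v) t .(suc v) inv@(_ , asc≡ , _ , bounded , _) good (there (here refl)) =
    extend-fresh good (≤suc-≡ (sym asc≡) ≤-refl) (bounded⇒∉ bounded ≤-refl) , climbing-climb inv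

  complete : ∀ σ t d → Inv σ t → Good P t → Good P (t ∷ʳ d) → d ∈ allowed σ
  complete zeros t d (asc≡ , _) _ good′ with ≤suc-≡ asc≡ (good-∷ʳ⇒bound good′)
  ... | z≤n = there (here refl)
  ... | s≤s z≤n = here refl
  complete ones t d (asc≡ , _) _ good′ with ≤suc-≡ asc≡ (good-∷ʳ⇒bound good′)
  ... | z≤n = there (there (here refl))
  ... | s≤s z≤n = here refl
  ... | s≤s (s≤s z≤n) = there (here refl)
  complete dipped t d (asc≡ , _ , _ , dip) _ good′@(_ , av₁ ∷ _ ∷ _ ∷ []) with ≤suc-≡ asc≡ (good-∷ʳ⇒bound good′)
  ... | z≤n = there (here refl)
  ... | s≤s z≤n = ⊥-elim (av₁ (contains-∷ʳ pat0101 dip (s≤s z≤n , refl , refl)))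
  ... | s≤s (s≤s z≤n) = here refl
  complete (climbing v) t d (2≤v , asc≡ , _ , _ , _ , below , _) _ good′@(_ , _ ∷ av₂ ∷ av₃ ∷ []) with <-cmp d v
  ... | tri≈ _ refl _ = here refl
  ... | tri> _ _ v<d with ≤-antisym (≤suc-≡ asc≡ (good-∷ʳ⇒bound good′)) v<d
  ...   | refl = there (here refl)
  complete (climbing v) t zero (2≤v , _ , _ , _ , _ , below , _) _ (_ , _ ∷ av₂ ∷ _ ∷ []) | tri< _ _ _ =
    ⊥-elim (av₂ (contains-∷ʳ pat0120 (below 1 ≤-refl 2≤v) (s≤s z≤n , 2≤v , refl)))
  complete (climbing v) t (suc d) (_ , _ , _ , _ , _ , below , _) _ (_ , _ ∷ _ ∷ av₃ ∷ []) | tri< d<v _ _ =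
    ⊥-elim (av₃ (contains-∷ʳ pat0121 (below (suc d) (s≤s z≤n) d<v) (s≤s z≤n , d<v , refl)))

  tree : GeneratingTree P
  tree = record
    { State = State ; root = zeros ; allowed = allowed ; next = next ; Inv = Inv
    ; allowed-unique = allowed-unique ; root-inv = refl , refl , [0]-bounded
    ; root-good = tt , singleton-avoids ∷ singleton-avoids ∷ singleton-avoids ∷ []
    ; grow = grow ; complete = complete
    }

  open Enumeration tree

  size-climbing : ∀ v L → size (climbing v) L ≡ 2 ^ L
  size-climbing v zero = refl
  size-climbing v (suc L) =
    trans (size-suc (climbing v) L) (cong₂ (λ x y → x + (y + 0)) (size-climbing v L) (size-climbing (suc v) L))

  size-dipped : ∀ L → size dipped L ≡ 2 ^ L
  size-dipped zero = refl
  size-dipped (suc L) =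
    trans (size-suc dipped L) (cong₂ (λ x y → x + (y + 0)) (size-climbing 2 L) (size-dipped L))

  size-ones : ∀ L → size ones L + 1 ≡ 2 ^ suc L
  size-ones zero = refl
  size-ones (suc L) = begin
    size ones (suc L) + 1                          ≡⟨ cong (_+ 1) (size-suc ones L) ⟩
    size ones L + (size (climbing 2) L + (size dipped L + 0)) + 1
      ≡⟨ cong₂ (λ x y → size ones L + (x + (y + 0)) + 1) (size-climbing 2 L) (size-dipped L) ⟩
    size ones L + 2 ^ suc L + 1                    ≡⟨ swap (size ones L) (2 ^ suc L) ⟩
    size ones L + 1 + 2 ^ suc L                    ≡⟨ cong (_+ 2 ^ suc L) (size-ones L) ⟩
    2 ^ suc L + 2 ^ suc L                          ≡⟨ cong (2 ^ suc L +_) (+-identityʳ (2 ^ suc L)) ⟨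
    2 ^ suc L + (2 ^ suc L + 0)                    ∎
    where
    open ≡-Reasoning
    swap : ∀ x y → x + y + 1 ≡ x + 1 + y
    swap = solve-∀

  count : ∀ n → 1 ≤ n → HasCount n P (2 ^ n ∸ n)
  count = hasCount-2^n∸n (size-root+n≡2^n ones size-root-suc size-ones)
    where
    size-root-suc : ∀ L → size zeros (suc L) ≡ size ones L + size zeros L
    size-root-suc L = trans (size-suc zeros L) (cong (size ones L +_) (+-identityʳ _))

module Avoid-0102-0120-0121 where

  P : List (List ℕ)
  P = p0102 ∷ p0120 ∷ p0121 ∷ []

  -- zeros: only 0's.  ones: 0⋯0 1⋯1.  binary: a ones sequence followed by a 0 and then any 0's and 1's.
  -- climbing v (v ≥ 2): weakly increasing through 0, 1, …, v, ending in v.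
  data State : Set where
    zeros ones binary : State
    climbing : ℕ → State

  allowed : State → List ℕ
  allowed zeros = 1 ∷ 0 ∷ []
  allowed ones = 1 ∷ 2 ∷ 0 ∷ []
  allowed binary = 1 ∷ 0 ∷ []
  allowed (climbing v) = v ∷ suc v ∷ []

  next : State → ℕ → State
  next zeros zero = zeros
  next zeros (suc _) = ones
  next ones zero = binary
  next ones (suc zero) = ones
  next ones (suc (suc _)) = climbing 2
  next binary _ = binary
  next (climbing v) d = climbing d

  allowed-unique : ∀ σ → Unique (allowed σ)
  allowed-unique zeros = ((λ ()) ∷ []) ∷ [] ∷ []
  allowed-unique ones = ((λ ()) ∷ (λ ()) ∷ []) ∷ ((λ ()) ∷ []) ∷ [] ∷ []
  allowed-unique binary = ((λ ()) ∷ []) ∷ [] ∷ []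
  allowed-unique (climbing v) = ((λ e → 1+n≢n (sym e)) ∷ []) ∷ [] ∷ []

  Inv : State → List ℕ → Set
  Inv zeros t = asc (0 ∷ t) ≡ 0 × lastOr 0 t ≡ 0 × Bounded 0 (0 ∷ t)
  Inv ones t = asc (0 ∷ t) ≡ 1 × lastOr 0 t ≡ 1 × Bounded 1 (0 ∷ t) × NonDecreasing (0 ∷ t) × Sub₂ 0 1 (0 ∷ t)
  Inv binary t = Bounded 1 (0 ∷ t) × Sub₃ 0 1 0 (0 ∷ t)
  Inv (climbing v) t =
    2 ≤ v × asc (0 ∷ t) ≡ v × lastOr 0 t ≡ v × Bounded v (0 ∷ t) × NonDecreasing (0 ∷ t) ×
    (∀ d → 1 ≤ d → d < v → Sub₃ 0 d v (0 ∷ t)) × Sub₂ 0 v (0 ∷ t)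

  extend : ∀ {t d} → Good P t → d ≤ suc (asc (0 ∷ t)) →
           NoEnding Is0102 (0 ∷ t) d → NoEnding Is0120 (0 ∷ t) d → NoEnding Is0121 (0 ∷ t) d → Good P (t ∷ʳ d)
  extend = good₃-∷ʳ pat0102 pat0120 pat0121

  extend-binary : ∀ {t d} → Good P t → d ≤ 1 → Bounded 1 (0 ∷ t) → Good P (t ∷ʳ d)
  extend-binary good d≤1 bounded =
    extend good (≤-trans d≤1 (s≤s z≤n)) (≤1⇒¬0102 d≤1) (bounded⇒¬0120 (bounded-weaken (s≤s z≤n) bounded))
      (binary⇒¬0121 bounded)

  climbing-stay : ∀ {v t} → Inv (climbing v) t → Inv (climbing v) (t ∷ʳ v)
  climbing-stay {v} {t} (2≤v , asc≡ , last≡ , bounded , nonDec , below , top) =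
    2≤v , trans (asc-∷ʳ-flat t (≤-reflexive (sym last≡))) asc≡ , lastOr-∷ʳ 0 t v , bounded-∷ʳ bounded ≤-refl ,
    nonDecreasing-∷ʳ nonDec bounded , (λ d 1≤d d<v → skipLast v (below d 1≤d d<v)) , skipLast v top

  climbing-climb : ∀ {v t} → Inv (climbing v) t → Inv (climbing (suc v)) (t ∷ʳ suc v)
  climbing-climb {v} {t} (2≤v , asc≡ , last≡ , bounded , nonDec , below , top) =
    m≤n⇒m≤1+n 2≤v , trans (asc-∷ʳ-rise t (s≤s (≤-reflexive last≡))) (cong suc asc≡) , lastOr-∷ʳ 0 t (suc v) ,
    bounded-∷ʳ bounded′ ≤-refl , nonDecreasing-∷ʳ nonDec bounded′ , below′ , keepLast (suc v) (Sub₁-head 0 t)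
    where
    bounded′ : Bounded (suc v) (0 ∷ t)
    bounded′ = bounded-weaken (n≤1+n v) bounded
    below′ : ∀ d → 1 ≤ d → d < suc v → Sub₃ 0 d (suc v) ((0 ∷ t) ∷ʳ suc v)
    below′ d 1≤d d<sv with m≤n⇒m<n∨m≡n (≤-pred d<sv)
    ... | inj₁ d<v = keepLast (suc v) (Sub₃⇒Sub₂ˡ (below d 1≤d d<v))
    ... | inj₂ refl = keepLast (suc v) top

  climbing-good : ∀ {v t d} → Inv (climbing v) t → Good P t → d ≤ suc v → v ≤ d → Good P (t ∷ʳ d)
  climbing-good (_ , asc≡ , _ , bounded , nonDec , _) good d≤ v≤d =
    extend good (≤suc-≡ (sym asc≡) d≤) (nonDecreasing⇒¬0102 nonDec)
      (bounded⇒¬0120 (bounded-weaken (m≤n⇒m≤1+n v≤d) bounded)) (bounded⇒¬0121 (bounded-weaken v≤d bounded))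

  grow : ∀ σ t d → Inv σ t → Good P t → d ∈ allowed σ → Good P (t ∷ʳ d) × Inv (next σ d) (t ∷ʳ d)
  grow zeros t .1 (asc≡ , last≡ , bounded) good (here refl) =
    extend-binary good ≤-refl bounded′ ,
    trans (asc-∷ʳ-rise t (s≤s (≤-reflexive last≡))) (cong suc asc≡) , lastOr-∷ʳ 0 t 1 , bounded-∷ʳ bounded′ ≤-refl ,
    nonDecreasing-∷ʳ (bounded⇒nonDecreasing bounded) bounded′ , keepLast 1 (Sub₁-head 0 t)
    where
    bounded′ : Bounded 1 (0 ∷ t)
    bounded′ = bounded-weaken z≤n bounded
  grow zeros t .0 (asc≡ , _ , bounded) good (there (here refl)) =
    extend-binary good z≤n (bounded-weaken z≤n bounded) ,
    trans (asc-∷ʳ-flat t z≤n) asc≡ , lastOr-∷ʳ 0 t 0 , bounded-∷ʳ bounded z≤n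
  grow ones t .1 (asc≡ , last≡ , bounded , nonDec , one) good (here refl) =
    extend-binary good ≤-refl bounded ,
    trans (asc-∷ʳ-flat t (≤-reflexive (sym last≡))) asc≡ , lastOr-∷ʳ 0 t 1 , bounded-∷ʳ bounded ≤-refl ,
    nonDecreasing-∷ʳ nonDec bounded , skipLast 1 one
  grow ones t .2 (asc≡ , last≡ , bounded , nonDec , one) good (there (here refl)) =
    extend good (≤suc-≡ (sym asc≡) ≤-refl) (nonDecreasing⇒¬0102 nonDec)
      (bounded⇒¬0120 (bounded-weaken (≤-trans (n≤1+n 1) (n≤1+n 2)) bounded)) (bounded⇒¬0121 bounded′) ,
    ≤-refl , trans (asc-∷ʳ-rise t (s≤s (≤-reflexive last≡))) (cong suc asc≡) , lastOr-∷ʳ 0 t 2 ,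
    bounded-∷ʳ bounded′ ≤-refl , nonDecreasing-∷ʳ nonDec bounded′ ,
    (λ { .1 (s≤s z≤n) (s≤s (s≤s z≤n)) → keepLast 2 one }) , keepLast 2 (Sub₁-head 0 t)
    where
    bounded′ : Bounded 2 (0 ∷ t)
    bounded′ = bounded-weaken (n≤1+n 1) bounded
  grow ones t .0 (_ , _ , bounded , _ , one) good (there (there (here refl))) =
    extend-binary good z≤n bounded , bounded-∷ʳ bounded z≤n , keepLast 0 one
  grow binary t .1 (bounded , dip) good (here refl) =
    extend-binary good ≤-refl bounded , bounded-∷ʳ bounded ≤-refl , skipLast 1 dip
  grow binary t .0 (bounded , dip) good (there (here refl)) =
    extend-binary good z≤n bounded , bounded-∷ʳ bounded z≤n , skipLast 0 dip
  grow (climbing v) t .v inv good (here refl) = climbing-good inv good (n≤1+n v) ≤-refl , climbing-stay inv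
  grow (climbing v) t .(suc v) inv good (there (here refl)) = climbing-good inv good ≤-refl (n≤1+n v) , climbing-climb inv

  complete : ∀ σ t d → Inv σ t → Good P t → Good P (t ∷ʳ d) → d ∈ allowed σ
  complete zeros t d (asc≡ , _) _ good′ with ≤suc-≡ asc≡ (good-∷ʳ⇒bound good′)
  ... | z≤n = there (here refl)
  ... | s≤s z≤n = here refl
  complete ones t d (asc≡ , _) _ good′ with ≤suc-≡ asc≡ (good-∷ʳ⇒bound good′)
  ... | z≤n = there (there (here refl))
  ... | s≤s z≤n = here refl
  ... | s≤s (s≤s z≤n) = there (here refl)
  complete binary t zero _ _ _ = there (here refl)
  complete binary t (suc zero) _ _ _ = here refl
  complete binary t (suc (suc d)) (_ , dip) _ (_ , av₁ ∷ _ ∷ _ ∷ []) =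
    ⊥-elim (av₁ (contains-∷ʳ pat0102 dip (s≤s z≤n , refl , s≤s (s≤s z≤n))))
  complete (climbing v) t d (2≤v , asc≡ , _ , _ , _ , below , _) _ good′ with <-cmp d v
  ... | tri≈ _ refl _ = here refl
  ... | tri> _ _ v<d with ≤-antisym (≤suc-≡ asc≡ (good-∷ʳ⇒bound good′)) v<d
  ...   | refl = there (here refl)
  complete (climbing v) t zero (2≤v , _ , _ , _ , _ , below , _) _ (_ , _ ∷ av₂ ∷ _ ∷ []) | tri< _ _ _ =
    ⊥-elim (av₂ (contains-∷ʳ pat0120 (below 1 ≤-refl 2≤v) (s≤s z≤n , 2≤v , refl)))
  complete (climbing v) t (suc d) (_ , _ , _ , _ , _ , below , _) _ (_ , _ ∷ _ ∷ av₃ ∷ []) | tri< d<v _ _ =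
    ⊥-elim (av₃ (contains-∷ʳ pat0121 (below (suc d) (s≤s z≤n) d<v) (s≤s z≤n , d<v , refl)))

  tree : GeneratingTree P
  tree = record
    { State = State ; root = zeros ; allowed = allowed ; next = next ; Inv = Inv
    ; allowed-unique = allowed-unique ; root-inv = refl , refl , [0]-bounded
    ; root-good = tt , singleton-avoids ∷ singleton-avoids ∷ singleton-avoids ∷ []
    ; grow = grow ; complete = complete
    }

  open Enumeration tree

  size-climbing : ∀ v L → size (climbing v) L ≡ 2 ^ L
  size-climbing v zero = refl
  size-climbing v (suc L) =
    trans (size-suc (climbing v) L) (cong₂ (λ x y → x + (y + 0)) (size-climbing v L) (size-climbing (suc v) L))

  size-binary : ∀ L → size binary L ≡ 2 ^ L
  size-binary zero = refl
  size-binary (suc L) = trans (size-suc binary L) (cong (λ x → x + (x + 0)) (size-binary L))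

  size-ones : ∀ L → size ones L + 1 ≡ 2 ^ suc L
  size-ones zero = refl
  size-ones (suc L) = begin
    size ones (suc L) + 1                          ≡⟨ cong (_+ 1) (size-suc ones L) ⟩
    size ones L + (size (climbing 2) L + (size binary L + 0)) + 1
      ≡⟨ cong₂ (λ x y → size ones L + (x + (y + 0)) + 1) (size-climbing 2 L) (size-binary L) ⟩
    size ones L + 2 ^ suc L + 1                    ≡⟨ swap (size ones L) (2 ^ suc L) ⟩
    size ones L + 1 + 2 ^ suc L                    ≡⟨ cong (_+ 2 ^ suc L) (size-ones L) ⟩
    2 ^ suc L + 2 ^ suc L                          ≡⟨ cong (2 ^ suc L +_) (+-identityʳ (2 ^ suc L)) ⟨
    2 ^ suc L + (2 ^ suc L + 0)                    ∎
    where
    open ≡-Reasoning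
    swap : ∀ x y → x + y + 1 ≡ x + 1 + y
    swap = solve-∀

  count : ∀ n → 1 ≤ n → HasCount n P (2 ^ n ∸ n)
  count = hasCount-2^n∸n (size-root+n≡2^n ones size-root-suc size-ones)
    where
    size-root-suc : ∀ L → size zeros (suc L) ≡ size ones L + size zeros L
    size-root-suc L = trans (size-suc zeros L) (cong (size ones L +_) (+-identityʳ _))

theorem4p3 : (n : ℕ) → 1 ≤ n →
    let k = 2 ^ n ∸ n in
    HasCount n ((0 ∷ 1 ∷ 0 ∷ 1 ∷ []) ∷ (0 ∷ 1 ∷ 0 ∷ 2 ∷ []) ∷ (0 ∷ 1 ∷ 1 ∷ 2 ∷ []) ∷ []) k ×
    HasCount n ((0 ∷ 1 ∷ 0 ∷ 1 ∷ []) ∷ (0 ∷ 1 ∷ 0 ∷ 2 ∷ []) ∷ (0 ∷ 1 ∷ 2 ∷ 0 ∷ []) ∷ []) k ×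
    HasCount n ((0 ∷ 1 ∷ 0 ∷ 1 ∷ []) ∷ (0 ∷ 1 ∷ 0 ∷ 2 ∷ []) ∷ (0 ∷ 1 ∷ 2 ∷ 1 ∷ []) ∷ []) k ×
    HasCount n ((0 ∷ 1 ∷ 0 ∷ 1 ∷ []) ∷ (0 ∷ 1 ∷ 1 ∷ 2 ∷ []) ∷ (0 ∷ 1 ∷ 2 ∷ 1 ∷ []) ∷ []) k ×
    HasCount n ((0 ∷ 1 ∷ 0 ∷ 1 ∷ []) ∷ (0 ∷ 1 ∷ 2 ∷ 0 ∷ []) ∷ (0 ∷ 1 ∷ 2 ∷ 1 ∷ []) ∷ []) k ×
    HasCount n ((0 ∷ 1 ∷ 0 ∷ 2 ∷ []) ∷ (0 ∷ 1 ∷ 2 ∷ 0 ∷ []) ∷ (0 ∷ 1 ∷ 2 ∷ 1 ∷ []) ∷ []) k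
theorem4p3 n 1≤n =
  Avoid-0101-0102-0112.count n 1≤n ,
  Avoid-0101-0102-0120.count n 1≤n ,
  Avoid-0101-0102-0121.count n 1≤n ,
  Avoid-0101-0112-0121.count n 1≤n ,
  Avoid-0101-0120-0121.count n 1≤n ,
  Avoid-0102-0120-0121.count n 1≤n
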